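{- Let $T$ be an $r$-ary GDH theory and let $\mathcal{F}$ be a family of $T$-graphs. Then $\pi_T(\mathcal{F}) = 0$ if and only if some member $F \in \mathcal{F}$ is a subGDH of the $t$-blowup of a single edge for some vector $t = (t_1,\ldots,t_r)$ of positive integers (i.e. $F$ has a copy in $S(t)$, where $S$ is the $T$-graph on $r$ vertices with exactly one edge). Otherwise, $\pi_T(\mathcal{F}) \geq \frac{m_T}{r^r}$.
   Context: Fix an integer $r \geq 2$ and a subgroup $J_T$ of $S_r$ (a GDH theory $T$), with $m_T := |J_T|$. A $T$-graph $G$ is a finite set $V_G$ with a relation $E_G \subseteq V_G^r$ such that every tuple in $E_G$ has pairwise distinct entries and $E_G$ is closed under permuting coordinates by elements of $J_T$. An edge is an orbit of $E_G$ under this $J_T$-action; $e_T(G)$ is the number of edges. A copy of $H$ in $G$ is an injective map $V_H \to V_G$ sending every tuple of $E_H$ to a tuple of $E_G$; $G$ is $\mathcal{F}$-free if it contains no copy of any member of $\mathcal{F}$. $\text{ex}_T(n,\mathcal{F})$ is the maximum number of edges in an $\mathcal{F}$-free $T$-graph on $n$ vertices and $\pi_T(\mathcal{F}) = \lim_{n\to\infty} \text{ex}_T(n,\mathcal{F})/\left(\frac{r!}{m_T}\binom{n}{r}\right)$. For a $T$-graph $G$ with $V_G = \{x_1,\ldots,x_n\}$ and positive integers $t = (t_1,\ldots,t_n)$, the $t$-blowup $G(t)$ has vertex set $\{x_{ij} : 1 \le i \le n, 1 \le j \le t_i\}$ and $(x_{i_1j_1},\ldots,x_{i_rj_r}) \in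 E_{G(t)}$ iff $(x_{i_1},\ldots,x_{i_r}) \in E_G$. -}

module Defs where

open import Data.Nat using (ℕ; zero; suc; _!; _+_; _*_; _^_; _≤_; _<_; _≤ᵇ_)
open import Data.Nat.Combinatorics using (_C_)
open import Data.Bool using (Bool; true; false; _∧_; if_then_else_; T)
open import Data.Fin as Fin using (Fin; toℕ; splitAt)
import Data.Fin.Properties as FinP
open import Data.Vec using (Vec; []; _∷_; lookup; tabulate; map)
open import Data.Vec.Properties using (≡-dec)
open import Data.List as List using (List; []; _∷_; length; concatMap; allFin)
open import Data.List.Membership.Propositional using (_∈_)
open import Data.List.Relation.Unary.Unique.Propositional using (Unique)
open import Data.List.Relation.Unary.Any using (any?)
open import Data.Sum using (inj₁; inj₂)
open import Data.Product using (Σ; ∃; _×_; _,_)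
open import Relation.Binary.PropositionalEquality using (_≡_)
open import Relation.Nullary.Decidable using (⌊_⌋)
open import Relation.Nullary using (¬_)

-- Permutations of Fin r, represented as vectors σ with σ[i] = lookup σ i.

idPerm : (r : ℕ) → Vec (Fin r) r
idPerm r = tabulate (λ i → i)

_⊙_ : ∀ {r} → Vec (Fin r) r → Vec (Fin r) r → Vec (Fin r) r
σ ⊙ τ = tabulate (λ i → lookup σ (lookup τ i))

Distinct : ∀ {A : Set} {k} → Vec A k → Set
Distinct {k = k} x = (i j : Fin k) → lookup x i ≡ lookup x j → i ≡ j

act : ∀ {r n} → Vec (Fin r) r → Vec (Fin n) r → Vec (Fin n) r
act σ x = tabulate (λ i → lookup x (lookup σ i))

-- A GDH theory: an arity r ≥ 2 and a subgroup J_T of S_r, given as a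
-- duplicate-free list of its elements (a finite nonempty subset of S_r
-- closed under composition is a subgroup).

record GDH : Set where
  field
    r      : ℕ
    2≤r    : 2 ≤ r
    J      : List (Vec (Fin r) r)
    J-perm : ∀ {σ} → σ ∈ J → Distinct σ
    J-uniq : Unique J
    J-id   : idPerm r ∈ J
    J-comp : ∀ {σ τ} → σ ∈ J → τ ∈ J → (σ ⊙ τ) ∈ J

  m : ℕ
  m = length J

open GDH public

allVecs : (n k : ℕ) → List (Vec (Fin n) k)
allVecs n zero    = [] ∷ []
allVecs n (suc k) = concatMap (λ i → List.map (i ∷_) (allVecs n k)) (allFin n)

-- injective numeric code of a tuple (base-n digits), used as a total order
code : ∀ {n k} → Vec (Fin n) k → ℕ
code {n} []       = 0
code {n} (i ∷ xs) = toℕ i + n * code xs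

allB : ∀ {A : Set} → (A → Bool) → List A → Bool
allB f []       = true
allB f (x ∷ xs) = f x ∧ allB f xs

countB : ∀ {A : Set} → (A → Bool) → List A → ℕ
countB f []       = 0
countB f (x ∷ xs) = (if f x then 1 else 0) + countB f xs

record TGraph (Th : GDH) : Set where
  field
    n        : ℕ
    E        : Vec (Fin n) (r Th) → Bool
    E-dist   : ∀ x → T (E x) → Distinct x
    E-closed : ∀ {σ} → σ ∈ J Th → ∀ x → T (E x) → T (E (act σ x))

open TGraph public

-- e_T(G): the number of J_T-orbits of E_G, counted via the unique
-- representative of each orbit that has minimal code.
eT : ∀ {Th} → TGraph Th → ℕ
eT {Th} G = countB isRep (allVecs (n G) (r Th))
  where
  isRep : Vec (Fin (n G)) (r Th) → Bool
  isRep x = E G x ∧ allB (λ σ → code x ≤ᵇ code (act σ x)) (J Th)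

Copy : ∀ {Th} → TGraph Th → (N : ℕ) → (Vec (Fin N) (r Th) → Bool) → Set
Copy {Th} H N E' =
  Σ (Fin (n H) → Fin N) λ φ →
    ((i j : Fin (n H)) → φ i ≡ φ j → i ≡ j) ×
    (∀ x → T (E H x) → T (E' (map φ x)))

Contains : ∀ {Th} → (TGraph Th → Set) → TGraph Th → Set
Contains 𝓕 G = ∃ λ F → 𝓕 F × Copy F (n G) (E G)

Free : ∀ {Th} → (TGraph Th → Set) → TGraph Th → Set
Free 𝓕 G = ¬ Contains 𝓕 G

-- The single edge S: vertex set Fin r, E_S = the J_T-orbit of (1,…,r).

singleEdgeE : (Th : GDH) → Vec (Fin (r Th)) (r Th) → Bool
singleEdgeE Th x = ⌊ any? (λ σ → ≡-dec Fin._≟_ x (act σ (idPerm (r Th)))) (J Th) ⌋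

-- Blowups: vertex set Fin (t₁ + … + t_k), vertex x_{ij} lies in class i.
sumV : ∀ {k} → Vec ℕ k → ℕ
sumV []       = 0
sumV (t ∷ ts) = t + sumV ts

cls : ∀ {k} (t : Vec ℕ k) → Fin (sumV t) → Fin k
cls (t ∷ ts) v with splitAt t v
... | inj₁ _ = Fin.zero
... | inj₂ w = Fin.suc (cls ts w)

blowupE : ∀ {k r} → (Vec (Fin k) r → Bool) → (t : Vec ℕ k) → Vec (Fin (sumV t)) r → Bool
blowupE E t y = E (map (cls t) y)

InBlowupOfEdge : (Th : GDH) → TGraph Th → Set
InBlowupOfEdge Th F =
  Σ (Vec ℕ (r Th)) λ t →
    ((i : Fin (r Th)) → 1 ≤ lookup t i) ×
    Copy F (sumV t) (blowupE (singleEdgeE Th) t)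

-- Turán density statements, unfolded (ε = p/q, normaliser (r!/m_T)·C(n,r)).

-- π_T(𝓕) = 0 :  for every ε > 0, for all large n, ex_T(n,𝓕) < ε·(r!/m_T)·C(n,r),
-- i.e. every T-graph on n vertices with e_T(G) ≥ ε·(r!/m_T)·C(n,r) contains
-- a copy of a member of 𝓕.
PiZero : (Th : GDH) → (TGraph Th → Set) → Set
PiZero Th 𝓕 =
  (p q : ℕ) → 1 ≤ p → 1 ≤ q →
  Σ ℕ λ N → (G : TGraph Th) → N ≤ n G →
    p * ((r Th) !) * (n G C r Th) ≤ q * m Th * eT G →
    Contains 𝓕 G

-- π_T(𝓕) ≥ a/b : for every ε > 0, for all large n there is an 𝓕-free
-- T-graph on n vertices with e_T(G) / ((r!/m_T)·C(n,r)) ≥ a/b − ε.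
PiAtLeast : (Th : GDH) → (TGraph Th → Set) → ℕ → ℕ → Set
PiAtLeast Th 𝓕 a b =
  (p q : ℕ) → 1 ≤ p → 1 ≤ q →
  Σ ℕ λ N → (n₀ : ℕ) → N ≤ n₀ →
    Σ (TGraph Th) λ G → n G ≡ n₀ × Free 𝓕 G ×
      a * q * ((r Th) !) * (n₀ C r Th) ≤
        eT G * m Th * b * q + p * b * ((r Th) !) * (n₀ C r Th)

-- Sufficiency is supersaturation. A T-graph with ε·n^r edges has a dense edge relation, and a
-- dense (k+1)-ary relation contains, by the power mean inequality applied to degrees, a t-tuple of
-- distinct vertices whose common link is a dense k-ary relation; induction on k yields an r × t
-- array of vertices all of whose transversals are edges. With rows as long as S(t) has vertices,
-- such an array contains S(t), since every edge of S(t) is a J_T-rearrangement of a transversal.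
--
-- Necessity and the lower bound come from the balanced blowup of an edge on n vertices, with parts
-- of size about n/r: it has about (n/r)^r edges, i.e. density tending to m_T/r^r, and it is 𝓕-free
-- unless some member of 𝓕 lies in a blowup of an edge.

module Submission where

open import Defs
open import Data.Nat
open import Data.Nat.Properties
open import Data.Nat.Tactic.RingSolver using (solve-∀)
open import Data.Nat.Combinatorics using (_C_; nCk≡nPk/k!)
open import Data.Nat.Combinatorics.Base using (_P′_; _P_)
open import Data.Nat.Combinatorics.Specification using (k!∣nP′k)
open import Data.Nat.DivMod using (_/_; _%_; m*[n/m]≡n; m/n*n≤m; m*n/n≡m; /-monoˡ-≤; m≡m%n+[m/n]*n; m%n<n)
open import Data.Bool using (Bool; true; false; _∧_; _∨_; not; if_then_else_; T)
open import Data.Bool.Properties using (T-∧; T-≡)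
open import Data.Fin as Fin using (Fin; toℕ; fromℕ; inject₁; lower₁; splitAt; _↑ˡ_; _↑ʳ_; opposite)
import Data.Fin.Properties as FinP
open import Data.Vec using (Vec; []; _∷_; lookup; tabulate; map; replicate)
import Data.Vec.Properties as VecP
open import Data.Vec.Relation.Unary.Any using (any?)
open import Data.Vec.Relation.Binary.Pointwise.Extensional using (ext; Pointwise-≡⇒≡)
open import Data.Vec.Membership.Propositional using () renaming (_∈_ to _∈ᵥ_)
open import Data.Vec.Membership.Propositional.Properties using (∈-lookup)
open import Data.List as List using (List; []; _∷_; length; concatMap; allFin; _++_)
import Data.List.Properties as ListP
open import Data.List.Membership.Propositional using (_∈_; find; lose)
open import Data.List.Relation.Unary.Any using (here; there)
open import Data.Product using (Σ; ∃; _×_; _,_; proj₁; proj₂)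
open import Data.Sum using (inj₁; inj₂)
open import Data.Empty using (⊥-elim)
open import Function.Bundles using (Equivalence; _⇔_; mk⇔)
open import Function.Definitions using (Injective)
open import Relation.Binary.PropositionalEquality hiding (J)
open import Relation.Nullary using (¬_; Dec; does; yes; no)
open import Relation.Nullary.Decidable using (toWitness; fromWitness)

private variable
  A B : Set

∑ : List A → (A → ℕ) → ℕ
∑ []       f = 0
∑ (x ∷ xs) f = f x + ∑ xs f

syntax ∑ xs (λ x → e) = ∑[ x ∈ xs ] e

∑-cong : ∀ (xs : List A) {f g : A → ℕ} → (∀ x → f x ≡ g x) → ∑ xs f ≡ ∑ xs g
∑-cong []       f≡g = refl
∑-cong (x ∷ xs) f≡g = cong₂ _+_ (f≡g x) (∑-cong xs f≡g)

∑-mono-≤ : ∀ (xs : List A) {f g : A → ℕ} → (∀ x → f x ≤ g x) → ∑ xs f ≤ ∑ xs g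
∑-mono-≤ []       f≤g = z≤n
∑-mono-≤ (x ∷ xs) f≤g = +-mono-≤ (f≤g x) (∑-mono-≤ xs f≤g)

∑-distrib-+ : ∀ (xs : List A) (f g : A → ℕ) → ∑[ x ∈ xs ] (f x + g x) ≡ ∑ xs f + ∑ xs g
∑-distrib-+ []       f g = refl
∑-distrib-+ (x ∷ xs) f g = begin
  f x + g x + ∑[ y ∈ xs ] (f y + g y) ≡⟨ cong (f x + g x +_) (∑-distrib-+ xs f g) ⟩
  f x + g x + (∑ xs f + ∑ xs g)       ≡⟨ +-assoc-swap (f x) (g x) (∑ xs f) (∑ xs g) ⟩
  f x + ∑ xs f + (g x + ∑ xs g)       ∎
  where
  open ≡-Reasoning
  +-assoc-swap : ∀ a b c d → a + b + (c + d) ≡ a + c + (b + d)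
  +-assoc-swap = solve-∀

∑-*ˡ : ∀ (xs : List A) (c : ℕ) (f : A → ℕ) → ∑[ x ∈ xs ] (c * f x) ≡ c * ∑ xs f
∑-*ˡ []       c f = sym (*-zeroʳ c)
∑-*ˡ (x ∷ xs) c f = trans (cong (c * f x +_) (∑-*ˡ xs c f)) (sym (*-distribˡ-+ c (f x) _))

∑-*ʳ : ∀ (xs : List A) (c : ℕ) (f : A → ℕ) → ∑[ x ∈ xs ] (f x * c) ≡ ∑ xs f * c
∑-*ʳ xs c f = trans (∑-cong xs (λ x → *-comm (f x) c)) (trans (∑-*ˡ xs c f) (*-comm c _))

∑-const : ∀ (xs : List A) (c : ℕ) → ∑[ _ ∈ xs ] c ≡ length xs * c
∑-const []       c = refl
∑-const (x ∷ xs) c = cong (c +_) (∑-const xs c)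

∑-zero : ∀ (xs : List A) → ∑[ _ ∈ xs ] 0 ≡ 0
∑-zero xs = trans (∑-const xs 0) (*-zeroʳ (length xs))

∑-comm : ∀ (xs : List A) (ys : List B) (f : A → B → ℕ) →
  ∑[ x ∈ xs ] ∑[ y ∈ ys ] f x y ≡ ∑[ y ∈ ys ] ∑[ x ∈ xs ] f x y
∑-comm []       ys f = sym (∑-zero ys)
∑-comm (x ∷ xs) ys f = trans (cong (∑ ys (f x) +_) (∑-comm xs ys f))
                             (sym (∑-distrib-+ ys (f x) (λ y → ∑[ x ∈ xs ] f x y)))

∑-++ : ∀ (xs ys : List A) (f : A → ℕ) → ∑ (xs ++ ys) f ≡ ∑ xs f + ∑ ys f
∑-++ []       ys f = refl
∑-++ (x ∷ xs) ys f = trans (cong (f x +_) (∑-++ xs ys f)) (sym (+-assoc (f x) _ _))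

∑-map : ∀ (g : A → B) (xs : List A) (f : B → ℕ) → ∑ (List.map g xs) f ≡ ∑[ x ∈ xs ] f (g x)
∑-map g []       f = refl
∑-map g (x ∷ xs) f = cong (f (g x) +_) (∑-map g xs f)

∑-concatMap : ∀ (g : A → List B) (xs : List A) (f : B → ℕ) →
  ∑ (concatMap g xs) f ≡ ∑[ x ∈ xs ] ∑ (g x) f
∑-concatMap g []       f = refl
∑-concatMap g (x ∷ xs) f =
  trans (∑-++ (g x) (concatMap g xs) f) (cong (∑ (g x) f +_) (∑-concatMap g xs f))

χ : Bool → ℕ
χ b = if b then 1 else 0

countB≡∑χ : ∀ (f : A → Bool) (xs : List A) → countB f xs ≡ ∑[ x ∈ xs ] χ (f x)
countB≡∑χ f []       = refl
countB≡∑χ f (x ∷ xs) = cong (χ (f x) +_) (countB≡∑χ f xs)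

allB-intro : ∀ (f : A → Bool) (xs : List A) → (∀ {x} → x ∈ xs → T (f x)) → T (allB f xs)
allB-intro f []       _     = _
allB-intro f (x ∷ xs) all-f = Equivalence.from T-∧ (all-f (here refl) , allB-intro f xs (λ x∈xs → all-f (there x∈xs)))

χ≤1 : ∀ b → χ b ≤ 1
χ≤1 true  = ≤-refl
χ≤1 false = z≤n

χ-∧ : ∀ a b → χ (a ∧ b) ≡ χ a * χ b
χ-∧ true  b = sym (+-identityʳ (χ b))
χ-∧ false b = refl

∑-allFin-suc : ∀ n (f : Fin (suc n) → ℕ) →
  ∑ (allFin (suc n)) f ≡ f Fin.zero + ∑[ i ∈ allFin n ] f (Fin.suc i)
∑-allFin-suc n f = cong (f Fin.zero +_)
  (trans (cong (λ l → ∑ l f) (sym (ListP.map-tabulate (λ i → i) Fin.suc))) (∑-map Fin.suc (allFin n) f))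

∑-allFin-const : ∀ n c → ∑[ _ ∈ allFin n ] c ≡ n * c
∑-allFin-const n c = trans (∑-const (allFin n) c) (cong (_* c) (ListP.length-tabulate {n = n} (λ i → i)))

∑-allFin-last : ∀ n (f : Fin (suc n) → ℕ) →
  ∑ (allFin (suc n)) f ≡ ∑[ i ∈ allFin n ] f (inject₁ i) + f (fromℕ n)
∑-allFin-last zero    f = +-identityʳ (f Fin.zero)
∑-allFin-last (suc n) f = begin
  ∑ (allFin (suc (suc n))) f
    ≡⟨ ∑-allFin-suc (suc n) f ⟩
  f Fin.zero + ∑[ i ∈ allFin (suc n) ] f (Fin.suc i)
    ≡⟨ cong (f Fin.zero +_) (∑-allFin-last n (λ i → f (Fin.suc i))) ⟩
  f Fin.zero + (∑[ i ∈ allFin n ] f (Fin.suc (inject₁ i)) + f (fromℕ (suc n)))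
    ≡⟨ sym (+-assoc (f Fin.zero) _ _) ⟩
  f Fin.zero + ∑[ i ∈ allFin n ] f (Fin.suc (inject₁ i)) + f (fromℕ (suc n))
    ≡⟨ cong (_+ f (fromℕ (suc n))) (sym (∑-allFin-suc n (λ i → f (inject₁ i)))) ⟩
  ∑[ i ∈ allFin (suc n) ] f (inject₁ i) + f (fromℕ (suc n)) ∎
  where open ≡-Reasoning

∑-allFin-opposite : ∀ n (f : Fin n → ℕ) → ∑[ i ∈ allFin n ] f (opposite i) ≡ ∑ (allFin n) f
∑-allFin-opposite zero    f = refl
∑-allFin-opposite (suc n) f = begin
  ∑[ i ∈ allFin (suc n) ] f (opposite i)
    ≡⟨ ∑-allFin-suc n (λ i → f (opposite i)) ⟩
  f (fromℕ n) + ∑[ i ∈ allFin n ] f (inject₁ (opposite i))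
    ≡⟨ cong (f (fromℕ n) +_) (∑-allFin-opposite n (λ i → f (inject₁ i))) ⟩
  f (fromℕ n) + ∑[ i ∈ allFin n ] f (inject₁ i)
    ≡⟨ +-comm (f (fromℕ n)) _ ⟩
  ∑[ i ∈ allFin n ] f (inject₁ i) + f (fromℕ n)
    ≡⟨ sym (∑-allFin-last n f) ⟩
  ∑ (allFin (suc n)) f ∎
  where open ≡-Reasoning

∑-allFin-+ : ∀ a b (f : Fin (a + b) → ℕ) →
  ∑ (allFin (a + b)) f ≡ ∑[ x ∈ allFin a ] f (x ↑ˡ b) + ∑[ y ∈ allFin b ] f (a ↑ʳ y)
∑-allFin-+ zero    b f = refl
∑-allFin-+ (suc a) b f = begin
  ∑ (allFin (suc (a + b))) f
    ≡⟨ ∑-allFin-suc (a + b) f ⟩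
  f Fin.zero + ∑[ i ∈ allFin (a + b) ] f (Fin.suc i)
    ≡⟨ cong (f Fin.zero +_) (∑-allFin-+ a b (λ i → f (Fin.suc i))) ⟩
  f Fin.zero + (∑[ x ∈ allFin a ] f (Fin.suc (x ↑ˡ b)) + Right)
    ≡⟨ sym (+-assoc (f Fin.zero) _ _) ⟩
  f Fin.zero + ∑[ x ∈ allFin a ] f (Fin.suc (x ↑ˡ b)) + Right
    ≡⟨ cong (_+ Right) (sym (∑-allFin-suc a (λ x → f (x ↑ˡ b)))) ⟩
  ∑[ x ∈ allFin (suc a) ] f (x ↑ˡ b) + Right ∎
  where
  open ≡-Reasoning
  Right = ∑[ y ∈ allFin b ] f (suc a ↑ʳ y)

∑-allVecs-suc : ∀ n k (f : Vec (Fin n) (suc k) → ℕ) →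
  ∑ (allVecs n (suc k)) f ≡ ∑[ i ∈ allFin n ] ∑[ y ∈ allVecs n k ] f (i ∷ y)
∑-allVecs-suc n k f = trans (∑-concatMap _ (allFin n) f)
                            (∑-cong (allFin n) (λ i → ∑-map (i ∷_) (allVecs n k) f))

∑-allVecs-const : ∀ n k c → ∑[ _ ∈ allVecs n k ] c ≡ n ^ k * c
∑-allVecs-const n zero    c = refl
∑-allVecs-const n (suc k) c = begin
  ∑[ _ ∈ allVecs n (suc k) ] c              ≡⟨ ∑-allVecs-suc n k (λ _ → c) ⟩
  ∑[ _ ∈ allFin n ] ∑[ _ ∈ allVecs n k ] c ≡⟨ ∑-cong (allFin n) (λ _ → ∑-allVecs-const n k c) ⟩
  ∑[ _ ∈ allFin n ] (n ^ k * c)             ≡⟨ ∑-allFin-const n (n ^ k * c) ⟩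
  n * (n ^ k * c)                           ≡⟨ sym (*-assoc n (n ^ k) c) ⟩
  n ^ suc k * c                             ∎
  where open ≡-Reasoning

length-allVecs : ∀ n k → length (allVecs n k) ≡ n ^ k
length-allVecs n k = begin
  length (allVecs n k)         ≡⟨ sym (*-identityʳ _) ⟩
  length (allVecs n k) * 1     ≡⟨ sym (∑-const (allVecs n k) 1) ⟩
  ∑[ _ ∈ allVecs n k ] 1       ≡⟨ ∑-allVecs-const n k 1 ⟩
  n ^ k * 1                    ≡⟨ *-identityʳ (n ^ k) ⟩
  n ^ k                        ∎
  where open ≡-Reasoning

∏ : (k : ℕ) → (Fin k → ℕ) → ℕ
∏ zero    h = 1
∏ (suc k) h = h Fin.zero * ∏ k (λ i → h (Fin.suc i))

∏-cong : ∀ k {h h′ : Fin k → ℕ} → (∀ i → h i ≡ h′ i) → ∏ k h ≡ ∏ k h′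
∏-cong zero    h≡h′ = refl
∏-cong (suc k) h≡h′ = cong₂ _*_ (h≡h′ Fin.zero) (∏-cong k (λ i → h≡h′ (Fin.suc i)))

∏-mono-≤ : ∀ k {h h′ : Fin k → ℕ} → (∀ i → h i ≤ h′ i) → ∏ k h ≤ ∏ k h′
∏-mono-≤ zero    h≤h′ = ≤-refl
∏-mono-≤ (suc k) h≤h′ = *-mono-≤ (h≤h′ Fin.zero) (∏-mono-≤ k (λ i → h≤h′ (Fin.suc i)))

∏-const : ∀ k c → ∏ k (λ _ → c) ≡ c ^ k
∏-const zero    c = refl
∏-const (suc k) c = cong (c *_) (∏-const k c)

∑-allVecs-∏ : ∀ n k (g : Fin k → Fin n → ℕ) →
  ∑[ y ∈ allVecs n k ] ∏ k (λ i → g i (lookup y i)) ≡ ∏ k (λ i → ∑ (allFin n) (g i))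
∑-allVecs-∏ n zero    g = refl
∑-allVecs-∏ n (suc k) g = begin
  ∑[ y ∈ allVecs n (suc k) ] ∏ (suc k) (λ i → g i (lookup y i))
    ≡⟨ ∑-allVecs-suc n k _ ⟩
  ∑[ x ∈ allFin n ] ∑[ y ∈ allVecs n k ] (g Fin.zero x * Rest y)
    ≡⟨ ∑-cong (allFin n) (λ x → ∑-*ˡ (allVecs n k) (g Fin.zero x) Rest) ⟩
  ∑[ x ∈ allFin n ] (g Fin.zero x * ∑ (allVecs n k) Rest)
    ≡⟨ ∑-*ʳ (allFin n) _ (g Fin.zero) ⟩
  ∑ (allFin n) (g Fin.zero) * ∑ (allVecs n k) Rest
    ≡⟨ cong (∑ (allFin n) (g Fin.zero) *_) (∑-allVecs-∏ n k (λ i → g (Fin.suc i))) ⟩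
  ∏ (suc k) (λ i → ∑ (allFin n) (g i)) ∎
  where
  open ≡-Reasoning
  Rest : Vec (Fin n) k → ℕ
  Rest y = ∏ k (λ i → g (Fin.suc i) (lookup y i))

∏-χ≤χ : ∀ k (b : Fin k → Bool) c → ((∀ i → T (b i)) → T c) → ∏ k (λ i → χ (b i)) ≤ χ c
∏-χ≤χ zero    b c all⇒c = subst (λ c → 1 ≤ χ c) (sym (Equivalence.to T-≡ (all⇒c λ ()))) ≤-refl
∏-χ≤χ (suc k) b c all⇒c with b Fin.zero in b₀
... | false = z≤n
... | true  = ≤-trans (≤-reflexive (+-identityʳ _))
                      (∏-χ≤χ k (λ i → b (Fin.suc i)) c λ rest → all⇒c λ where
                        Fin.zero    → subst T (sym b₀) _
                        (Fin.suc i) → rest i)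

-- Power means

^-distribʳ-* : ∀ a b k → (a * b) ^ k ≡ a ^ k * b ^ k
^-distribʳ-* a b zero    = refl
^-distribʳ-* a b (suc k) = trans (cong (a * b *_) (^-distribʳ-* a b k)) (interchange a b (a ^ k) (b ^ k))
  where
  interchange : ∀ a b x y → a * b * (x * y) ≡ a * x * (b * y)
  interchange = solve-∀

rearrangement : ∀ {a b p q} → a ≤ b → p ≤ q → a * q + b * p ≤ a * p + b * q
rearrangement {a} {p = p} {q} a≤b p≤q with m≤n⇒∃[o]m+o≡n a≤b
... | d , refl = begin
  a * q + (a + d) * p   ≡⟨ expandˡ a d p q ⟩
  a * p + a * q + d * p ≤⟨ +-monoʳ-≤ (a * p + a * q) (*-monoʳ-≤ d p≤q) ⟩
  a * p + a * q + d * q ≡⟨ expandʳ a d p q ⟩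
  a * p + (a + d) * q   ∎
  where
  open ≤-Reasoning
  expandˡ : ∀ a d p q → a * q + (a + d) * p ≡ a * p + a * q + d * p
  expandˡ = solve-∀
  expandʳ : ∀ a d p q → a * p + a * q + d * q ≡ a * p + (a + d) * q
  expandʳ = solve-∀

*-^-rearrangement : ∀ a b j → a * b ^ j + b * a ^ j ≤ a ^ suc j + b ^ suc j
*-^-rearrangement a b j with ≤-total a b
... | inj₁ a≤b = rearrangement a≤b (^-monoˡ-≤ j a≤b)
... | inj₂ b≤a = subst₂ _≤_ (+-comm (b * a ^ j) _) (+-comm (b ^ suc j) _)
                         (rearrangement b≤a (^-monoˡ-≤ j b≤a))

∑-chebyshev : ∀ (xs : List A) (f : A → ℕ) j →
  ∑ xs f * ∑[ x ∈ xs ] (f x ^ j) ≤ length xs * ∑[ x ∈ xs ] (f x ^ suc j)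
∑-chebyshev xs f j = *-cancelˡ-≤ 2 (begin
  2 * (S * Sʲ)
    ≡⟨ sym double-sum-lhs ⟩
  ∑[ x ∈ xs ] ∑[ y ∈ xs ] (f x * f y ^ j + f y * f x ^ j)
    ≤⟨ ∑-mono-≤ xs (λ x → ∑-mono-≤ xs (λ y → *-^-rearrangement (f x) (f y) j)) ⟩
  ∑[ x ∈ xs ] ∑[ y ∈ xs ] (f x ^ suc j + f y ^ suc j)
    ≡⟨ double-sum-rhs ⟩
  2 * (L * Sʲ⁺¹) ∎)
  where
  open ≤-Reasoning
  S = ∑ xs f
  Sʲ = ∑[ x ∈ xs ] (f x ^ j)
  Sʲ⁺¹ = ∑[ x ∈ xs ] (f x ^ suc j)
  L = length xs
  double : ∀ a → a + a ≡ 2 * a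
  double a = cong (a +_) (sym (+-identityʳ a))
  double-sum-lhs : ∑[ x ∈ xs ] ∑[ y ∈ xs ] (f x * f y ^ j + f y * f x ^ j) ≡ 2 * (S * Sʲ)
  double-sum-lhs = begin-equality
    ∑[ x ∈ xs ] ∑[ y ∈ xs ] (f x * f y ^ j + f y * f x ^ j)
      ≡⟨ ∑-cong xs (λ x → ∑-distrib-+ xs _ _) ⟩
    ∑[ x ∈ xs ] (∑[ y ∈ xs ] (f x * f y ^ j) + ∑[ y ∈ xs ] (f y * f x ^ j))
      ≡⟨ ∑-cong xs (λ x → cong₂ _+_ (∑-*ˡ xs (f x) _) (∑-*ʳ xs (f x ^ j) f)) ⟩
    ∑[ x ∈ xs ] (f x * Sʲ + S * f x ^ j)
      ≡⟨ ∑-distrib-+ xs _ _ ⟩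
    ∑[ x ∈ xs ] (f x * Sʲ) + ∑[ x ∈ xs ] (S * f x ^ j)
      ≡⟨ cong₂ _+_ (∑-*ʳ xs Sʲ f) (∑-*ˡ xs S _) ⟩
    S * Sʲ + S * Sʲ
      ≡⟨ double (S * Sʲ) ⟩
    2 * (S * Sʲ) ∎
  double-sum-rhs : ∑[ x ∈ xs ] ∑[ y ∈ xs ] (f x ^ suc j + f y ^ suc j) ≡ 2 * (L * Sʲ⁺¹)
  double-sum-rhs = begin-equality
    ∑[ x ∈ xs ] ∑[ y ∈ xs ] (f x ^ suc j + f y ^ suc j)
      ≡⟨ ∑-cong xs (λ x → ∑-distrib-+ xs _ _) ⟩
    ∑[ x ∈ xs ] (∑[ _ ∈ xs ] (f x ^ suc j) + Sʲ⁺¹)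
      ≡⟨ ∑-cong xs (λ x → cong (_+ Sʲ⁺¹) (∑-const xs (f x ^ suc j))) ⟩
    ∑[ x ∈ xs ] (L * f x ^ suc j + Sʲ⁺¹)
      ≡⟨ ∑-distrib-+ xs _ _ ⟩
    ∑[ x ∈ xs ] (L * f x ^ suc j) + ∑[ _ ∈ xs ] Sʲ⁺¹
      ≡⟨ cong₂ _+_ (∑-*ˡ xs L _) (∑-const xs Sʲ⁺¹) ⟩
    L * Sʲ⁺¹ + L * Sʲ⁺¹
      ≡⟨ double (L * Sʲ⁺¹) ⟩
    2 * (L * Sʲ⁺¹) ∎

∑-power-mean : ∀ (xs : List A) (f : A → ℕ) k →
  ∑ xs f ^ suc k ≤ length xs ^ k * ∑[ x ∈ xs ] (f x ^ suc k)
∑-power-mean xs f zero = begin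
  ∑ xs f * 1        ≡⟨ *-identityʳ _ ⟩
  ∑ xs f            ≡⟨ ∑-cong xs (λ x → sym (*-identityʳ (f x))) ⟩
  ∑[ x ∈ xs ] (f x ^ 1) ≡⟨ sym (+-identityʳ _) ⟩
  1 * ∑[ x ∈ xs ] (f x ^ 1) ∎
  where open ≤-Reasoning
∑-power-mean xs f (suc k) = begin
  S * S ^ suc k                      ≤⟨ *-monoʳ-≤ S (∑-power-mean xs f k) ⟩
  S * (L ^ k * ∑[ x ∈ xs ] (f x ^ suc k)) ≡⟨ x∙yz≈y∙xz S (L ^ k) _ ⟩
  L ^ k * (S * ∑[ x ∈ xs ] (f x ^ suc k)) ≤⟨ *-monoʳ-≤ (L ^ k) (∑-chebyshev xs f (suc k)) ⟩
  L ^ k * (L * ∑[ x ∈ xs ] (f x ^ suc (suc k))) ≡⟨ x∙yz≈y∙xz (L ^ k) L _ ⟩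
  L * (L ^ k * ∑[ x ∈ xs ] (f x ^ suc (suc k))) ≡⟨ sym (*-assoc L (L ^ k) _) ⟩
  L ^ suc k * ∑[ x ∈ xs ] (f x ^ suc (suc k)) ∎
  where
  open ≤-Reasoning
  open import Algebra.Properties.CommutativeSemigroup *-commutativeSemigroup using (x∙yz≈y∙xz)
  S = ∑ xs f
  L = length xs

count : ∀ {n k} → (Vec (Fin n) k → Bool) → ℕ
count {n} {k} E = ∑[ y ∈ allVecs n k ] χ (E y)

count≤n^k : ∀ {n k} (E : Vec (Fin n) k → Bool) → count E ≤ n ^ k
count≤n^k {n} {k} E = begin
  count E                ≤⟨ ∑-mono-≤ (allVecs n k) (λ y → χ≤1 (E y)) ⟩
  ∑[ _ ∈ allVecs n k ] 1 ≡⟨ ∑-allVecs-const n k 1 ⟩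
  n ^ k * 1              ≡⟨ *-identityʳ (n ^ k) ⟩
  n ^ k                  ∎
  where open ≤-Reasoning

degree : ∀ {n k} → (Vec (Fin n) (suc k) → Bool) → Vec (Fin n) k → ℕ
degree {n} E y = ∑[ i ∈ allFin n ] χ (E (i ∷ y))

count≡∑degree : ∀ {n k} (E : Vec (Fin n) (suc k) → Bool) → count E ≡ ∑ (allVecs n k) (degree E)
count≡∑degree {n} {k} E = trans (∑-allVecs-suc n k (λ y → χ (E y))) (∑-comm (allFin n) (allVecs n k) _)

allᵇ : ∀ {m} → (A → Bool) → Vec A m → Bool
allᵇ h []      = true
allᵇ h (x ∷ s) = h x ∧ allᵇ h s

χ-allᵇ : ∀ {m} (h : A → Bool) (s : Vec A m) → χ (allᵇ h s) ≡ ∏ m (λ i → χ (h (lookup s i)))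
χ-allᵇ h []      = refl
χ-allᵇ h (x ∷ s) = trans (χ-∧ (h x) _) (cong (χ (h x) *_) (χ-allᵇ h s))

allᵇ-lookup : ∀ {m} (h : A → Bool) (s : Vec A m) → T (allᵇ h s) → ∀ j → T (h (lookup s j))
allᵇ-lookup h (x ∷ s) p Fin.zero    = proj₁ (Equivalence.to T-∧ p)
allᵇ-lookup h (x ∷ s) p (Fin.suc j) = allᵇ-lookup h s (proj₂ (Equivalence.to T-∧ p)) j

commonLink : ∀ {n k t} → Vec (Fin n) t → (Vec (Fin n) (suc k) → Bool) → Vec (Fin n) k → Bool
commonLink s E y = allᵇ (λ x → E (x ∷ y)) s

linkMass : ∀ {n k} t → (Vec (Fin n) (suc k) → Bool) → ℕ
linkMass {n} t E = ∑[ s ∈ allVecs n t ] count (commonLink s E)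

linkMass≡∑degree^t : ∀ {n k} t (E : Vec (Fin n) (suc k) → Bool) →
  linkMass t E ≡ ∑[ y ∈ allVecs n k ] (degree E y ^ t)
linkMass≡∑degree^t {n} {k} t E = begin
  ∑[ s ∈ allVecs n t ] ∑[ y ∈ allVecs n k ] χ (commonLink s E y)
    ≡⟨ ∑-comm (allVecs n t) (allVecs n k) _ ⟩
  ∑[ y ∈ allVecs n k ] ∑[ s ∈ allVecs n t ] χ (commonLink s E y)
    ≡⟨ ∑-cong (allVecs n k) (λ y → ∑-cong (allVecs n t) (λ s → χ-allᵇ (λ x → E (x ∷ y)) s)) ⟩
  ∑[ y ∈ allVecs n k ] ∑[ s ∈ allVecs n t ] ∏ t (λ i → χ (E (lookup s i ∷ y)))
    ≡⟨ ∑-cong (allVecs n k) (λ y → ∑-allVecs-∏ n t (λ _ x → χ (E (x ∷ y)))) ⟩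
  ∑[ y ∈ allVecs n k ] ∏ t (λ _ → degree E y)
    ≡⟨ ∑-cong (allVecs n k) (λ y → ∏-const t (degree E y)) ⟩
  ∑[ y ∈ allVecs n k ] (degree E y ^ t) ∎
  where open ≡-Reasoning

-- does, unlike ⌊_⌋, computes through any? on _∷_, which the counting below relies on
infix 4 _∈?_
_∈?_ : ∀ {n m} (x : Fin n) (s : Vec (Fin n) m) → Dec (x ∈ᵥ s)
x ∈? s = any? (x FinP.≟_) s

distinctᵇ : ∀ {n m} → Vec (Fin n) m → Bool
distinctᵇ []      = true
distinctᵇ (x ∷ s) = not (does (x ∈? s)) ∧ distinctᵇ s

distinct-∷ : ∀ {k} {x : A} {s : Vec A k} → ¬ x ∈ᵥ s → Distinct s → Distinct (x ∷ s)
distinct-∷         x∉s ds Fin.zero    Fin.zero    _ = refl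
distinct-∷ {s = s} x∉s ds Fin.zero    (Fin.suc j) e = ⊥-elim (x∉s (subst (_∈ᵥ s) (sym e) (∈-lookup j s)))
distinct-∷ {s = s} x∉s ds (Fin.suc i) Fin.zero    e = ⊥-elim (x∉s (subst (_∈ᵥ s) e (∈-lookup i s)))
distinct-∷         x∉s ds (Fin.suc i) (Fin.suc j) e = cong Fin.suc (ds i j e)

does-true : ∀ {P : Set} (P? : Dec P) → T (does P?) → P
does-true (yes p) _ = p

does-false : ∀ {P : Set} (P? : Dec P) → T (not (does P?)) → ¬ P
does-false (no ¬p) _ = ¬p

distinctᵇ-sound : ∀ {n m} (s : Vec (Fin n) m) → T (distinctᵇ s) → Distinct s
distinctᵇ-sound (x ∷ s) p = distinct-∷ (does-false (x ∈? s) x∉s) (distinctᵇ-sound s s-distinct)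
  where
  x∉s = proj₁ (Equivalence.to T-∧ p)
  s-distinct = proj₂ (Equivalence.to T-∧ p)

χ-∨ : ∀ a b → χ (a ∨ b) ≤ χ a + χ b
χ-∨ true  b = s≤s z≤n
χ-∨ false b = ≤-refl

χ-not-∧ : ∀ a b → χ (not (not a ∧ b)) ≤ χ a + χ (not b)
χ-not-∧ true  b     = s≤s z≤n
χ-not-∧ false true  = z≤n
χ-not-∧ false false = ≤-refl

∑-χ≟ : ∀ {n} (x : Fin n) → ∑[ i ∈ allFin n ] χ (does (i FinP.≟ x)) ≡ 1
∑-χ≟ {suc n} Fin.zero    = trans (∑-allFin-suc n (λ i → χ (does (i FinP.≟ Fin.zero))))
                                  (cong suc (∑-zero (allFin n)))
∑-χ≟ {suc n} (Fin.suc x) = trans (∑-allFin-suc n (λ i → χ (does (i FinP.≟ Fin.suc x)))) (∑-χ≟ x)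

∑-χ∈ : ∀ {n m} (s : Vec (Fin n) m) → ∑[ i ∈ allFin n ] χ (does (i ∈? s)) ≤ m
∑-χ∈ {n} []      = ≤-reflexive (∑-zero (allFin n))
∑-χ∈ {n} (x ∷ s) = begin
  ∑[ i ∈ allFin n ] χ (does (i ∈? x ∷ s))
    ≤⟨ ∑-mono-≤ (allFin n) χ-∈?-∷ ⟩
  ∑[ i ∈ allFin n ] (χ (does (i FinP.≟ x)) + χ (does (i ∈? s)))
    ≡⟨ ∑-distrib-+ (allFin n) _ _ ⟩
  ∑[ i ∈ allFin n ] χ (does (i FinP.≟ x)) + ∑[ i ∈ allFin n ] χ (does (i ∈? s))
    ≤⟨ +-mono-≤ (≤-reflexive (∑-χ≟ x)) (∑-χ∈ s) ⟩
  suc _ ∎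
  where
  open ≤-Reasoning
  χ-∈?-∷ : ∀ i → χ (does (i ∈? x ∷ s)) ≤ χ (does (i FinP.≟ x)) + χ (does (i ∈? s))
  χ-∈?-∷ i = χ-∨ (does (i FinP.≟ x)) (does (i ∈? s))

nonDistinct : ℕ → ℕ → ℕ
nonDistinct n t = ∑[ s ∈ allVecs n t ] χ (not (distinctᵇ s))

nonDistinct-step : ∀ n t → nonDistinct n (suc t) ≤ t * n ^ t + n * nonDistinct n t
nonDistinct-step n t = begin
  nonDistinct n (suc t)
    ≡⟨ ∑-allVecs-suc n t _ ⟩
  ∑[ i ∈ allFin n ] ∑[ s ∈ allVecs n t ] χ (not (not (does (i ∈? s)) ∧ distinctᵇ s))
    ≤⟨ ∑-mono-≤ (allFin n) (λ i → ∑-mono-≤ (allVecs n t) (λ s → χ-not-∧ (does (i ∈? s)) (distinctᵇ s))) ⟩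
  ∑[ i ∈ allFin n ] ∑[ s ∈ allVecs n t ] (χ (does (i ∈? s)) + χ (not (distinctᵇ s)))
    ≡⟨ ∑-cong (allFin n) (λ i → ∑-distrib-+ (allVecs n t) _ _) ⟩
  ∑[ i ∈ allFin n ] (∑[ s ∈ allVecs n t ] χ (does (i ∈? s)) + nonDistinct n t)
    ≡⟨ ∑-distrib-+ (allFin n) _ _ ⟩
  ∑[ i ∈ allFin n ] ∑[ s ∈ allVecs n t ] χ (does (i ∈? s)) + ∑[ _ ∈ allFin n ] nonDistinct n t
    ≡⟨ cong₂ _+_ (∑-comm (allFin n) (allVecs n t) _) (∑-allFin-const n _) ⟩
  ∑[ s ∈ allVecs n t ] ∑[ i ∈ allFin n ] χ (does (i ∈? s)) + n * nonDistinct n t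
    ≤⟨ +-monoˡ-≤ (n * nonDistinct n t) (∑-mono-≤ (allVecs n t) ∑-χ∈) ⟩
  ∑[ _ ∈ allVecs n t ] t + n * nonDistinct n t
    ≡⟨ cong (_+ n * nonDistinct n t) (trans (∑-allVecs-const n t t) (*-comm (n ^ t) t)) ⟩
  t * n ^ t + n * nonDistinct n t ∎
  where open ≤-Reasoning

nonDistinct-bound : ∀ n t → nonDistinct n t * n ≤ t * t * n ^ t
nonDistinct-bound n zero    = z≤n
nonDistinct-bound n (suc t) = begin
  nonDistinct n (suc t) * n
    ≤⟨ *-monoˡ-≤ n (nonDistinct-step n t) ⟩
  (t * n ^ t + n * nonDistinct n t) * n
    ≡⟨ regroup t (n ^ t) n (nonDistinct n t) ⟩
  t * (n * n ^ t) + n * (nonDistinct n t * n)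
    ≤⟨ +-monoʳ-≤ (t * (n * n ^ t)) (*-monoʳ-≤ n (nonDistinct-bound n t)) ⟩
  t * (n * n ^ t) + n * (t * t * n ^ t)
    ≡⟨ collect t n (n ^ t) ⟩
  (t + t * t) * (n * n ^ t)
    ≤⟨ *-monoˡ-≤ (n * n ^ t) (subst (t + t * t ≤_) (sym (square-suc t)) (m≤m+n (t + t * t) (suc t))) ⟩
  suc t * suc t * (n * n ^ t) ∎
  where
  open ≤-Reasoning
  regroup : ∀ t P n b → (t * P + n * b) * n ≡ t * (n * P) + n * (b * n)
  regroup = solve-∀
  collect : ∀ t n P → t * (n * P) + n * (t * t * P) ≡ (t + t * t) * (n * P)
  collect = solve-∀
  square-suc : ∀ t → suc t * suc t ≡ (t + t * t) + suc t
  square-suc = solve-∀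

-- Supersaturation of complete k-partite k-graphs

∑-pigeonhole : ∀ (xs : List A) (g : A → ℕ) {B c} → 0 < length xs →
  length xs * B ≤ c * ∑ xs g → ∃ λ x → B ≤ c * g x
∑-pigeonhole (x ∷ xs) g {B} {c} _ mass with B ≤? c * g x | xs
... | yes B≤cgx | _      = x , B≤cgx
... | no  B≰cgx | []     = ⊥-elim (B≰cgx (subst₂ _≤_ (+-identityʳ B) (cong (c *_) (+-identityʳ (g x))) mass))
... | no  B≰cgx | y ∷ ys = ∑-pigeonhole (y ∷ ys) g {B} {c} (s≤s z≤n) (+-cancelˡ-≤ B _ _ (begin
  B + length (y ∷ ys) * B         ≤⟨ subst (B + length (y ∷ ys) * B ≤_) (*-distribˡ-+ c (g x) _) mass ⟩
  c * g x + c * ∑ (y ∷ ys) g      ≤⟨ +-monoˡ-≤ _ (<⇒≤ (≰⇒> B≰cgx)) ⟩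
  B + c * ∑ (y ∷ ys) g            ∎))
  where open ≤-Reasoning

≤-absorb : ∀ {n X c G B Q} → 1 ≤ n → X ≤ c * (G + B) → B * n ≤ Q * X → 2 * c * Q ≤ n → X ≤ 2 * c * G
≤-absorb {n@(suc _)} {X} {c} {G} {B} {Q} _ X≤ B-small 2cQ≤n = *-cancelˡ-≤ n (+-cancelʳ-≤ (n * X) _ _ (begin
  n * X + n * X                ≡⟨ double (n * X) ⟩
  2 * (n * X)                  ≤⟨ *-monoʳ-≤ 2 nX≤ ⟩
  2 * (n * (c * G) + c * (Q * X)) ≡⟨ regroup n c G Q X ⟩
  n * (2 * c * G) + 2 * c * Q * X ≤⟨ +-monoʳ-≤ (n * (2 * c * G)) (*-monoˡ-≤ X 2cQ≤n) ⟩
  n * (2 * c * G) + n * X      ∎))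
  where
  open ≤-Reasoning
  double : ∀ a → a + a ≡ 2 * a
  double a = cong (a +_) (sym (+-identityʳ a))
  distrib : ∀ n c G B → n * (c * (G + B)) ≡ n * (c * G) + c * (B * n)
  distrib = solve-∀
  regroup : ∀ n c G Q X → 2 * (n * (c * G) + c * (Q * X)) ≡ n * (2 * c * G) + 2 * c * Q * X
  regroup = solve-∀
  nX≤ : n * X ≤ n * (c * G) + c * (Q * X)
  nX≤ = begin
    n * X                     ≤⟨ *-monoʳ-≤ n X≤ ⟩
    n * (c * (G + B))         ≡⟨ distrib n c G B ⟩
    n * (c * G) + c * (B * n) ≤⟨ +-monoʳ-≤ (n * (c * G)) (*-monoʳ-≤ c B-small) ⟩
    n * (c * G) + c * (Q * X) ∎

linkMass-lower : ∀ {n k} t′ c (E : Vec (Fin n) (suc k) → Bool) → 1 ≤ n →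
  n ^ suc k ≤ c * count E → n ^ suc t′ * n ^ k ≤ c ^ suc t′ * linkMass (suc t′) E
linkMass-lower {n@(suc _)} {k} t′ c E _ dense =
  *-cancelˡ-≤ ((n ^ k) ^ t′) {{m^n≢0 (n ^ k) t′ {{m^n≢0 n k}}}} (begin
    (n ^ k) ^ t′ * (n ^ t * n ^ k)   ≡⟨ regroup (n ^ t) (n ^ k) ((n ^ k) ^ t′) ⟩
    n ^ t * (n ^ k) ^ t             ≡⟨ sym (^-distribʳ-* n (n ^ k) t) ⟩
    (n ^ suc k) ^ t                 ≤⟨ ^-monoˡ-≤ t dense ⟩
    (c * count E) ^ t               ≡⟨ ^-distribʳ-* c (count E) t ⟩
    c ^ t * count E ^ t             ≤⟨ *-monoʳ-≤ (c ^ t) power-mean ⟩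
    c ^ t * ((n ^ k) ^ t′ * linkMass t E) ≡⟨ x∙yz≈y∙xz (c ^ t) ((n ^ k) ^ t′) _ ⟩
    (n ^ k) ^ t′ * (c ^ t * linkMass t E) ∎)
  where
  open ≤-Reasoning
  open import Algebra.Properties.CommutativeSemigroup *-commutativeSemigroup using (x∙yz≈y∙xz)
  t = suc t′
  regroup : ∀ a b c → c * (a * b) ≡ a * (b * c)
  regroup = solve-∀
  power-mean : count E ^ t ≤ (n ^ k) ^ t′ * linkMass t E
  power-mean = begin
    count E ^ t
      ≡⟨ cong (_^ t) (count≡∑degree E) ⟩
    ∑ (allVecs n k) (degree E) ^ t
      ≤⟨ ∑-power-mean (allVecs n k) (degree E) t′ ⟩
    length (allVecs n k) ^ t′ * ∑[ y ∈ allVecs n k ] (degree E y ^ t)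
      ≡⟨ cong₂ _*_ (cong (_^ t′) (length-allVecs n k)) (sym (linkMass≡∑degree^t t E)) ⟩
    (n ^ k) ^ t′ * linkMass t E ∎

χ-split : ∀ b x → x ≡ χ b * x + χ (not b) * x
χ-split true  x = sym (trans (+-identityʳ (x + 0)) (+-identityʳ x))
χ-split false x = sym (+-identityʳ x)

nonDistinct-linkMass : ∀ {n k} t (E : Vec (Fin n) (suc k) → Bool) →
  ∑[ s ∈ allVecs n t ] (χ (not (distinctᵇ s)) * count (commonLink s E)) * n ≤ t * t * (n ^ t * n ^ k)
nonDistinct-linkMass {n} {k} t E = begin
  ∑[ s ∈ allVecs n t ] (χ (not (distinctᵇ s)) * count (commonLink s E)) * n
    ≤⟨ *-monoˡ-≤ n (∑-mono-≤ (allVecs n t) (λ s → *-monoʳ-≤ (χ (not (distinctᵇ s))) (count≤n^k (commonLink s E)))) ⟩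
  ∑[ s ∈ allVecs n t ] (χ (not (distinctᵇ s)) * n ^ k) * n
    ≡⟨ cong (_* n) (∑-*ʳ (allVecs n t) (n ^ k) _) ⟩
  nonDistinct n t * n ^ k * n
    ≡⟨ *-right-comm (nonDistinct n t) (n ^ k) n ⟩
  nonDistinct n t * n * n ^ k
    ≤⟨ *-monoˡ-≤ (n ^ k) (nonDistinct-bound n t) ⟩
  t * t * n ^ t * n ^ k
    ≡⟨ *-assoc (t * t) (n ^ t) (n ^ k) ⟩
  t * t * (n ^ t * n ^ k) ∎
  where
  open ≤-Reasoning
  *-right-comm : ∀ a b c → a * b * c ≡ a * c * b
  *-right-comm = solve-∀

χ-support : ∀ {B c} b x → 1 ≤ B → B ≤ c * (χ b * x) → T b × B ≤ c * x
χ-support {B} {c} true  x _   B≤ = _ , subst (λ y → B ≤ c * y) (+-identityʳ x) B≤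
χ-support {B} {c} false x 1≤B B≤ = ⊥-elim (<⇒≱ 1≤B (≤-trans B≤ (≤-reflexive (*-zeroʳ c))))

-- Tuples with a repeated entry carry at most a t²/n-fraction of the link mass, so once
-- n ≥ 2 c^t t² the tuples of distinct vertices carry half of it; then use pigeonhole.
distinct-dense-commonLink : ∀ {n k} t′ c (E : Vec (Fin n) (suc k) → Bool) → 1 ≤ n →
  2 * c ^ suc t′ * (suc t′ * suc t′) ≤ n → n ^ suc k ≤ c * count E →
  ∃ λ s → T (distinctᵇ s) × n ^ k ≤ 2 * c ^ suc t′ * count (commonLink s E)
distinct-dense-commonLink {n} {k} t′ c E 1≤n n-large dense =
  s , χ-support {c = 2 * c ^ suc t′} (distinctᵇ s) (link s) (m^n>0 n {{>-nonZero 1≤n}} k) dense-at-s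
  where
  t = suc t′
  link : Vec (Fin n) t → ℕ
  link s = count (commonLink s E)
  onDistinct onRepeated : Vec (Fin n) t → ℕ
  onDistinct s = χ (distinctᵇ s) * link s
  onRepeated s = χ (not (distinctᵇ s)) * link s
  split : linkMass t E ≡ ∑ (allVecs n t) onDistinct + ∑ (allVecs n t) onRepeated
  split = trans (∑-cong (allVecs n t) (λ s → χ-split (distinctᵇ s) (link s))) (∑-distrib-+ (allVecs n t) _ _)
  absorbed : n ^ t * n ^ k ≤ 2 * c ^ t * ∑ (allVecs n t) onDistinct
  absorbed = ≤-absorb {c = c ^ t} {B = ∑ (allVecs n t) onRepeated} {Q = t * t} 1≤n
    (subst (λ m → n ^ t * n ^ k ≤ c ^ t * m) split (linkMass-lower t′ c E 1≤n dense))
    (nonDistinct-linkMass t E) n-large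
  mass : length (allVecs n t) * n ^ k ≤ 2 * c ^ t * ∑ (allVecs n t) onDistinct
  mass = subst (λ l → l * n ^ k ≤ 2 * c ^ t * ∑ (allVecs n t) onDistinct) (sym (length-allVecs n t)) absorbed
  pigeonhole : ∃ λ s → n ^ k ≤ 2 * c ^ t * onDistinct s
  pigeonhole = ∑-pigeonhole (allVecs n t) onDistinct {n ^ k} {2 * c ^ t}
                 (subst (0 <_) (sym (length-allVecs n t)) (m^n>0 n {{>-nonZero 1≤n}} t)) mass
  s = proj₁ pigeonhole
  dense-at-s = proj₂ pigeonhole

-- a copy in E of the complete k-partite k-graph with k parts of size t
record Box {n k} (t : ℕ) (E : Vec (Fin n) k → Bool) : Set where
  field
    vertex        : Fin k → Fin t → Fin n
    row-injective : ∀ i → Injective _≡_ _≡_ (vertex i)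
    transversal   : (f : Fin k → Fin t) → T (E (tabulate (λ i → vertex i (f i))))

box-∷ : ∀ {n k t} {E : Vec (Fin n) (suc k) → Bool} (s : Vec (Fin n) t) →
  Distinct s → Box t (commonLink s E) → Box t E
box-∷ {E = E} s distinct box = record
  { vertex        = vertex
  ; row-injective = row-injective
  ; transversal   = λ f → allᵇ-lookup (λ x → E (x ∷ tabulate (λ i → Box.vertex box i (f (Fin.suc i))))) s
                                      (Box.transversal box (λ i → f (Fin.suc i))) (f Fin.zero)
  }
  where
  vertex : Fin _ → Fin _ → Fin _
  vertex Fin.zero    = lookup s
  vertex (Fin.suc i) = Box.vertex box i
  row-injective : ∀ i → Injective _≡_ _≡_ (vertex i)
  row-injective Fin.zero    = distinct _ _
  row-injective (Fin.suc i) = Box.row-injective box i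

box-supersaturation : ∀ k t c → 1 ≤ c →
  ∃ λ N → ∀ {n} → N ≤ n → (E : Vec (Fin n) k → Bool) → n ^ k ≤ c * count E → Box t E
box-supersaturation zero t c _ = 0 , box
  where
  nullary : ∀ {n} (E : Vec (Fin n) 0 → Bool) → 1 ≤ c * count E → T (E [])
  nullary E dense with E []
  ... | true  = _
  ... | false = ⊥-elim (<⇒≱ dense (≤-reflexive (*-zeroʳ c)))
  box : ∀ {n} → 0 ≤ n → (E : Vec (Fin n) 0 → Bool) → 1 ≤ c * count E → Box t E
  box _ E dense = record { vertex = λ (); row-injective = λ (); transversal = λ _ → nullary E dense }
box-supersaturation (suc k) zero c _ = 0 , λ _ _ _ →
  record { vertex = λ _ (); row-injective = λ _ {a} → ⊥-elim (FinP.¬Fin0 a)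
         ; transversal = λ f → ⊥-elim (FinP.¬Fin0 (f Fin.zero)) }
box-supersaturation (suc k) (suc t′) c 1≤c = N , box
  where
  t = suc t′
  c′ = 2 * c ^ t
  1≤c′ : 1 ≤ c′
  1≤c′ = ≤-trans (m^n>0 c {{>-nonZero 1≤c}} t) (m≤m+n (c ^ t) (c ^ t + 0))
  induction = box-supersaturation k t c′ 1≤c′
  N′ = proj₁ induction
  N = suc (N′ + c′ * (t * t))
  box : ∀ {n} → N ≤ n → (E : Vec (Fin n) (suc k) → Bool) → n ^ suc k ≤ c * count E → Box t E
  box {n} N≤n E dense = box-∷ s (distinctᵇ-sound s distinct) (proj₂ induction N′≤n (commonLink s E) link-dense)
    where
    1≤n : 1 ≤ n
    1≤n = ≤-trans (s≤s z≤n) N≤n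
    N′≤n : N′ ≤ n
    N′≤n = ≤-trans (≤-trans (m≤m+n N′ _) (n≤1+n _)) N≤n
    n-large : c′ * (t * t) ≤ n
    n-large = ≤-trans (≤-trans (m≤n+m _ N′) (n≤1+n _)) N≤n
    witness = distinct-dense-commonLink t′ c E 1≤n n-large dense
    s = proj₁ witness
    distinct = proj₁ (proj₂ witness)
    link-dense = proj₂ (proj₂ witness)

-- Sufficiency

lookup-act : ∀ {r n} (σ : Vec (Fin r) r) (x : Vec (Fin n) r) i → lookup (act σ x) i ≡ lookup x (lookup σ i)
lookup-act σ x i = VecP.lookup∘tabulate _ i

act-idPerm : ∀ {r} (σ : Vec (Fin r) r) → act σ (idPerm r) ≡ σ
act-idPerm {r} σ = Pointwise-≡⇒≡ (ext λ i →
  trans (lookup-act σ (idPerm r) i) (VecP.lookup∘tabulate (λ j → j) (lookup σ i)))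

singleEdge⇒∈J : (Th : GDH) (x : Vec (Fin (r Th)) (r Th)) → T (singleEdgeE Th x) → x ∈ J Th
singleEdge⇒∈J Th x p with find (toWitness p)
... | σ , σ∈J , x≡σ = subst (_∈ J Th) (sym (trans x≡σ (act-idPerm σ))) σ∈J

∈J⇒singleEdge : (Th : GDH) (x : Vec (Fin (r Th)) (r Th)) → x ∈ J Th → T (singleEdgeE Th x)
∈J⇒singleEdge Th x x∈J = fromWitness (lose x∈J (sym (act-idPerm x)))

box-rows-disjoint : ∀ {Th} (G : TGraph Th) {t} (box : Box t (E G)) →
  ∀ i j a b → Box.vertex box i a ≡ Box.vertex box j b → i ≡ j
box-rows-disjoint {Th} G box i j a b e with j FinP.≟ i
... | yes j≡i = sym j≡i
... | no  j≢i = E-dist G w (Box.transversal box f) i j (trans w[i] (trans e (sym w[j])))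
  where
  open Box box using (vertex)
  f : Fin (r Th) → Fin _
  f l with l FinP.≟ i
  ... | yes _ = a
  ... | no  _ = b
  w = tabulate (λ l → vertex l (f l))
  w[i] : lookup w i ≡ vertex i a
  w[i] rewrite VecP.lookup∘tabulate (λ l → vertex l (f l)) i with i FinP.≟ i
  ... | yes _   = refl
  ... | no  i≢i = ⊥-elim (i≢i refl)
  w[j] : lookup w j ≡ vertex j b
  w[j] rewrite VecP.lookup∘tabulate (λ l → vertex l (f l)) j with j FinP.≟ i
  ... | yes j≡i = ⊥-elim (j≢i j≡i)
  ... | no  _   = refl

preimage : ∀ {k} → Vec (Fin k) k → Fin k → Fin k
preimage σ l with FinP.any? (λ i → lookup σ i FinP.≟ l)
... | yes (i , _) = i
... | no  _       = l

preimage-lookup : ∀ {k} (σ : Vec (Fin k) k) → Distinct σ → ∀ i → preimage σ (lookup σ i) ≡ i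
preimage-lookup σ distinct i with FinP.any? (λ j → lookup σ j FinP.≟ lookup σ i)
... | yes (j , σj≡σi) = distinct j i σj≡σi
... | no  ∄j          = ⊥-elim (∄j (i , refl))

-- v ↦ vertex (cls t v) v embeds S(t) into G: every edge of S(t) is a J_T-rearrangement of a transversal
copy-from-box : ∀ {Th} (G F : TGraph Th) (t : Vec ℕ (r Th)) →
  Copy F (sumV t) (blowupE (singleEdgeE Th) t) → Box (sumV t) (E G) → Copy F (n G) (E G)
copy-from-box {Th} G F t (ψ , ψ-injective , ψ-edges) box = (λ v → φ (ψ v)) , injective , edges
  where
  open Box box using (vertex; row-injective; transversal)
  φ : Fin (sumV t) → Fin (n G)
  φ v = vertex (cls t v) v
  φ-injective : ∀ u v → φ u ≡ φ v → u ≡ v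
  φ-injective u v e with box-rows-disjoint G box (cls t u) (cls t v) u v e
  ... | same-class = row-injective (cls t u) (trans e (cong (λ i → vertex i v) (sym same-class)))
  injective : ∀ i j → φ (ψ i) ≡ φ (ψ j) → i ≡ j
  injective i j e = ψ-injective i j (φ-injective (ψ i) (ψ j) e)
  edges : ∀ x → T (E F x) → T (E G (map (λ v → φ (ψ v)) x))
  edges x x∈F = subst (λ z → T (E G z)) act-σ-w≡ (E-closed G σ∈J w (transversal f))
    where
    y = map ψ x
    σ = map (cls t) y
    σ∈J : σ ∈ J Th
    σ∈J = singleEdge⇒∈J Th σ (ψ-edges x x∈F)
    f : Fin (r Th) → Fin (sumV t)
    f l = lookup y (preimage σ l)
    w = tabulate (λ l → vertex l (f l))
    act-σ-w≡ : act σ w ≡ map (λ v → φ (ψ v)) x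
    act-σ-w≡ = Pointwise-≡⇒≡ (ext λ i → begin
      lookup (act σ w) i                               ≡⟨ lookup-act σ w i ⟩
      lookup w (lookup σ i)                            ≡⟨ VecP.lookup∘tabulate _ (lookup σ i) ⟩
      vertex (lookup σ i) (lookup y (preimage σ (lookup σ i)))
        ≡⟨ cong (λ j → vertex (lookup σ i) (lookup y j)) (preimage-lookup σ (J-perm Th σ∈J) i) ⟩
      vertex (lookup σ i) (lookup y i)                 ≡⟨ cong (λ c → vertex c (lookup y i)) (VecP.lookup-map i (cls t) y) ⟩
      φ (lookup y i)                                   ≡⟨ cong φ (VecP.lookup-map i ψ x) ⟩
      φ (ψ (lookup x i))                               ≡⟨ sym (VecP.lookup-map i (λ v → φ (ψ v)) x) ⟩
      lookup (map (λ v → φ (ψ v)) x) i                 ∎)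
      where open ≡-Reasoning

k!*nCk≡nP′k : ∀ {n k} → k ≤ n → k ! * (n C k) ≡ n P′ k
k!*nCk≡nP′k {n} {k} k≤n = begin
  k ! * (n C k)              ≡⟨ cong (k ! *_) (nCk≡nPk/k! k≤n) ⟩
  k ! * ((n P k) / k !)      ≡⟨ cong (λ m → k ! * (m / k !)) nPk≡nP′k ⟩
  k ! * ((n P′ k) / k !)     ≡⟨ m*[n/m]≡n (k!∣nP′k k≤n) ⟩
  n P′ k                     ∎
  where
  open ≡-Reasoning
  instance _ = k !≢0
  nPk≡nP′k : n P k ≡ n P′ k
  nPk≡nP′k with k ≤ᵇ n | ≤⇒≤ᵇ k≤n
  ... | true | _ = refl

[n∸k]^k≤nP′k : ∀ n k → (n ∸ k) ^ k ≤ n P′ k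
[n∸k]^k≤nP′k n zero    = ≤-refl
[n∸k]^k≤nP′k n (suc k) =
  *-mono-≤ (∸-monoʳ-≤ n (n≤1+n k)) (≤-trans (^-monoˡ-≤ k (∸-monoʳ-≤ n (n≤1+n k))) ([n∸k]^k≤nP′k n k))

nP′k≤n^k : ∀ n k → n P′ k ≤ n ^ k
nP′k≤n^k n zero    = ≤-refl
nP′k≤n^k n (suc k) = *-mono-≤ (m∸n≤m n k) (nP′k≤n^k n k)

[n∸k]^k≤k!*nCk : ∀ {n k} → k ≤ n → (n ∸ k) ^ k ≤ k ! * (n C k)
[n∸k]^k≤k!*nCk {n} {k} k≤n = subst ((n ∸ k) ^ k ≤_) (sym (k!*nCk≡nP′k k≤n)) ([n∸k]^k≤nP′k n k)

k!*nCk≤n^k : ∀ {n k} → k ≤ n → k ! * (n C k) ≤ n ^ k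
k!*nCk≤n^k {n} {k} k≤n = subst (_≤ n ^ k) (sym (k!*nCk≡nP′k k≤n)) (nP′k≤n^k n k)

n^k≤2^k*k!*nCk : ∀ {n k} → 2 * k ≤ n → n ^ k ≤ 2 ^ k * (k ! * (n C k))
n^k≤2^k*k!*nCk {n} {k} 2k≤n = begin
  n ^ k                    ≤⟨ ^-monoˡ-≤ k n≤2[n∸k] ⟩
  (2 * (n ∸ k)) ^ k        ≡⟨ ^-distribʳ-* 2 (n ∸ k) k ⟩
  2 ^ k * (n ∸ k) ^ k      ≤⟨ *-monoʳ-≤ (2 ^ k) ([n∸k]^k≤k!*nCk k≤n) ⟩
  2 ^ k * (k ! * (n C k))  ∎
  where
  open ≤-Reasoning
  k≤n : k ≤ n
  k≤n = ≤-trans (m≤m+n k (k + 0)) 2k≤n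
  k≤n∸k : k ≤ n ∸ k
  k≤n∸k = subst (_≤ n ∸ k) (m+n∸n≡m k k) (∸-monoˡ-≤ k (subst (_≤ n) (cong (k +_) (+-identityʳ k)) 2k≤n))
  n≤2[n∸k] : n ≤ 2 * (n ∸ k)
  n≤2[n∸k] = begin
    n                  ≡⟨ sym (m+[n∸m]≡n k≤n) ⟩
    k + (n ∸ k)        ≤⟨ +-monoˡ-≤ (n ∸ k) k≤n∸k ⟩
    (n ∸ k) + (n ∸ k)  ≡⟨ cong ((n ∸ k) +_) (sym (+-identityʳ (n ∸ k))) ⟩
    2 * (n ∸ k)        ∎

1≤m : (Th : GDH) → 1 ≤ m Th
1≤m Th with J Th | J-id Th
... | _ ∷ _ | _ = s≤s z≤n

eT≤count : ∀ {Th} (G : TGraph Th) → eT G ≤ count (E G)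
eT≤count {Th} G = subst (_≤ count (E G)) (sym (countB≡∑χ _ (allVecs (n G) (r Th))))
  (∑-mono-≤ (allVecs (n G) (r Th)) (λ x → subst (_≤ χ (E G x)) (sym (χ-∧ (E G x) _)) (*-χ≤ (χ (E G x)) _)))
  where
  *-χ≤ : ∀ a b → a * χ b ≤ a
  *-χ≤ a true  = ≤-reflexive (*-identityʳ a)
  *-χ≤ a false = ≤-trans (≤-reflexive (*-zeroʳ a)) z≤n

blowup⇒PiZero : (Th : GDH) (𝓕 : TGraph Th → Set) → (∃ λ F → 𝓕 F × InBlowupOfEdge Th F) → PiZero Th 𝓕
blowup⇒PiZero Th 𝓕 (F , F∈𝓕 , t , _ , F⊆S[t]) p q 1≤p 1≤q = N + 2 * r Th , contains
  where
  c = 2 ^ r Th * q * m Th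
  1≤c : 1 ≤ c
  1≤c = *-mono-≤ (*-mono-≤ (m^n>0 2 (r Th)) 1≤q) (1≤m Th)
  supersaturation = box-supersaturation (r Th) (sumV t) c 1≤c
  N = proj₁ supersaturation
  contains : (G : TGraph Th) → N + 2 * r Th ≤ n G →
    p * r Th ! * (n G C r Th) ≤ q * m Th * eT G → Contains 𝓕 G
  contains G N+2r≤n many-edges =
    F , F∈𝓕 , copy-from-box G F t F⊆S[t] (proj₂ supersaturation (≤-trans (m≤m+n N _) N+2r≤n) (E G) dense)
    where
    open ≤-Reasoning
    rr = r Th
    dense : n G ^ rr ≤ c * count (E G)
    dense = begin
      n G ^ rr                             ≤⟨ n^k≤2^k*k!*nCk {k = rr} (≤-trans (m≤n+m (2 * rr) N) N+2r≤n) ⟩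
      2 ^ rr * (rr ! * (n G C rr))         ≤⟨ *-monoʳ-≤ (2 ^ rr) (m≤n*m _ p {{>-nonZero 1≤p}}) ⟩
      2 ^ rr * (p * (rr ! * (n G C rr)))   ≡⟨ cong (2 ^ rr *_) (sym (*-assoc p (rr !) _)) ⟩
      2 ^ rr * (p * rr ! * (n G C rr))     ≤⟨ *-monoʳ-≤ (2 ^ rr) many-edges ⟩
      2 ^ rr * (q * m Th * eT G)           ≤⟨ *-monoʳ-≤ (2 ^ rr) (*-monoʳ-≤ (q * m Th) (eT≤count G)) ⟩
      2 ^ rr * (q * m Th * count (E G))    ≡⟨ regroup (2 ^ rr) q (m Th) (count (E G)) ⟩
      c * count (E G)                      ∎
      where
      regroup : ∀ a b c d → a * (b * c * d) ≡ a * b * c * d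
      regroup = solve-∀

codeF : ℕ → (k : ℕ) → (Fin k → ℕ) → ℕ
codeF n zero    w = 0
codeF n (suc k) w = w Fin.zero + n * codeF n k (λ i → w (Fin.suc i))

code≡codeF : ∀ {n k} (v : Vec (Fin n) k) → code v ≡ codeF n k (λ i → toℕ (lookup v i))
code≡codeF     []      = refl
code≡codeF {n} (x ∷ v) = cong (λ c → toℕ x + n * c) (code≡codeF v)

codeF-cong : ∀ n k {w w′ : Fin k → ℕ} → (∀ i → w i ≡ w′ i) → codeF n k w ≡ codeF n k w′
codeF-cong n zero    w≡w′ = refl
codeF-cong n (suc k) w≡w′ = cong₂ (λ a b → a + n * b) (w≡w′ Fin.zero) (codeF-cong n k (λ i → w≡w′ (Fin.suc i)))

codeF-last : ∀ n k (w : Fin (suc k) → ℕ) →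
  codeF n (suc k) w ≡ codeF n k (λ i → w (inject₁ i)) + n ^ k * w (fromℕ k)
codeF-last n zero    w = solve-zero (w Fin.zero) n
  where
  solve-zero : ∀ a n → a + n * 0 ≡ 0 + 1 * a
  solve-zero = solve-∀
codeF-last n (suc k) w =
  trans (cong (λ c → w Fin.zero + n * c) (codeF-last n k (λ i → w (Fin.suc i))))
        (regroup (w Fin.zero) n (codeF n k (λ i → w (Fin.suc (inject₁ i)))) (n ^ k) (w (Fin.suc (fromℕ k))))
  where
  regroup : ∀ a n c p b → a + n * (c + p * b) ≡ a + n * c + n * p * b
  regroup = solve-∀

codeF<n^k : ∀ n k (w : Fin k → ℕ) → (∀ i → w i < n) → codeF n k w < n ^ k
codeF<n^k n zero    w _   = s≤s z≤n
codeF<n^k n (suc k) w w<n = begin-strict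
  w Fin.zero + n * c <⟨ +-monoˡ-< (n * c) (w<n Fin.zero) ⟩
  n + n * c          ≡⟨ sym (*-suc n c) ⟩
  n * suc c          ≤⟨ *-monoʳ-≤ n (codeF<n^k n k (λ i → w (Fin.suc i)) (λ i → w<n (Fin.suc i))) ⟩
  n * n ^ k          ∎
  where
  open ≤-Reasoning
  c = codeF n k (λ i → w (Fin.suc i))

module Restriction {k} (σ : Fin (suc k) → Fin (suc k)) (σ-injective : Injective _≡_ _≡_ σ)
                   (fixes-top : σ (fromℕ k) ≡ fromℕ k) where

  misses-top : ∀ i → k ≢ toℕ (σ (inject₁ i))
  misses-top i k≡σi = FinP.fromℕ≢inject₁ (sym (σ-injective (trans σi≡top (sym fixes-top))))
    where
    σi≡top : σ (inject₁ i) ≡ fromℕ k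
    σi≡top = FinP.toℕ-injective (trans (sym k≡σi) (sym (FinP.toℕ-fromℕ k)))

  restrict : Fin k → Fin k
  restrict i = lower₁ (σ (inject₁ i)) (misses-top i)

  inject₁-restrict : ∀ i → inject₁ (restrict i) ≡ σ (inject₁ i)
  inject₁-restrict i = FinP.inject₁-lower₁ (σ (inject₁ i)) (misses-top i)

  restrict-injective : Injective _≡_ _≡_ restrict
  restrict-injective {i} {j} e = FinP.inject₁-injective (σ-injective (begin
    σ (inject₁ i)        ≡⟨ sym (inject₁-restrict i) ⟩
    inject₁ (restrict i) ≡⟨ cong inject₁ e ⟩
    inject₁ (restrict j) ≡⟨ inject₁-restrict j ⟩
    σ (inject₁ j)        ∎))
    where open ≡-Reasoning

-- The top digit is the most significant one: either σ fixes the top position and we recurse on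
-- the restriction of σ, or σ brings a strictly larger digit there.
codeF-decreasing-least : ∀ n k (w : Fin k → ℕ) (σ : Fin k → Fin k) → Injective _≡_ _≡_ σ →
  (∀ {i j} → i Fin.< j → w j < w i) → (∀ i → w i < n) → codeF n k w ≤ codeF n k (λ i → w (σ i))
codeF-decreasing-least n zero    w σ _ _ _ = z≤n
codeF-decreasing-least n (suc k) w σ σ-injective decreasing w<n with σ (fromℕ k) FinP.≟ fromℕ k
... | yes fixes-top = begin
  codeF n (suc k) w
    ≡⟨ codeF-last n k w ⟩
  codeF n k w′ + n ^ k * w (fromℕ k)
    ≤⟨ +-monoˡ-≤ _ (codeF-decreasing-least n k w′ restrict restrict-injective decreasing′ (λ i → w<n (inject₁ i))) ⟩
  codeF n k (λ i → w′ (restrict i)) + n ^ k * w (fromℕ k)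
    ≡⟨ cong₂ _+_ (codeF-cong n k (λ i → cong w (inject₁-restrict i))) (cong (λ j → n ^ k * w j) (sym fixes-top)) ⟩
  codeF n k (λ i → w (σ (inject₁ i))) + n ^ k * w (σ (fromℕ k))
    ≡⟨ sym (codeF-last n k (λ i → w (σ i))) ⟩
  codeF n (suc k) (λ i → w (σ i)) ∎
  where
  open ≤-Reasoning
  open Restriction σ σ-injective fixes-top
  w′ : Fin k → ℕ
  w′ i = w (inject₁ i)
  decreasing′ : ∀ {i j} → i Fin.< j → w′ j < w′ i
  decreasing′ {i} {j} i<j =
    decreasing (subst₂ _<_ (sym (FinP.toℕ-inject₁ i)) (sym (FinP.toℕ-inject₁ j)) i<j)
... | no moves-top = begin
  codeF n (suc k) w
    ≡⟨ codeF-last n k w ⟩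
  codeF n k (λ i → w (inject₁ i)) + n ^ k * w (fromℕ k)
    <⟨ +-monoˡ-< _ (codeF<n^k n k _ (λ i → w<n (inject₁ i))) ⟩
  n ^ k + n ^ k * w (fromℕ k)
    ≡⟨ sym (*-suc (n ^ k) _) ⟩
  n ^ k * suc (w (fromℕ k))
    ≤⟨ *-monoʳ-≤ (n ^ k) (decreasing σtop<top) ⟩
  n ^ k * w (σ (fromℕ k))
    ≤⟨ m≤n+m _ _ ⟩
  codeF n k (λ i → w (σ (inject₁ i))) + n ^ k * w (σ (fromℕ k))
    ≡⟨ sym (codeF-last n k (λ i → w (σ i))) ⟩
  codeF n (suc k) (λ i → w (σ i)) ∎
  where
  open ≤-Reasoning
  σtop<top : σ (fromℕ k) Fin.< fromℕ k
  σtop<top = subst (toℕ (σ (fromℕ k)) <_) (sym (FinP.toℕ-fromℕ k))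
    (≤∧≢⇒< (s≤s⁻¹ (FinP.toℕ<n (σ (fromℕ k))))
           (λ e → moves-top (FinP.toℕ-injective (trans e (sym (FinP.toℕ-fromℕ k))))))

cls-↑ˡ : ∀ {k} a (ts : Vec ℕ k) (x : Fin a) → cls (a ∷ ts) (x ↑ˡ sumV ts) ≡ Fin.zero
cls-↑ˡ a ts x rewrite FinP.splitAt-↑ˡ a x (sumV ts) = refl

cls-↑ʳ : ∀ {k} a (ts : Vec ℕ k) (y : Fin (sumV ts)) → cls (a ∷ ts) (a ↑ʳ y) ≡ Fin.suc (cls ts y)
cls-↑ʳ a ts y rewrite FinP.splitAt-↑ʳ a (sumV ts) y = refl

class-size : ∀ {k} (t : Vec ℕ k) (i : Fin k) → ∑[ v ∈ allFin (sumV t) ] χ (does (cls t v FinP.≟ i)) ≡ lookup t i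
class-size (a ∷ ts) i = trans (∑-allFin-+ a (sumV ts) (λ v → χ (does (cls (a ∷ ts) v FinP.≟ i)))) (split i)
  where
  split : ∀ i → ∑[ x ∈ allFin a ] χ (does (cls (a ∷ ts) (x ↑ˡ sumV ts) FinP.≟ i))
              + ∑[ y ∈ allFin (sumV ts) ] χ (does (cls (a ∷ ts) (a ↑ʳ y) FinP.≟ i)) ≡ lookup (a ∷ ts) i
  split Fin.zero = begin
    ∑[ x ∈ allFin a ] χ (does (cls (a ∷ ts) (x ↑ˡ sumV ts) FinP.≟ Fin.zero))
      + ∑[ y ∈ allFin (sumV ts) ] χ (does (cls (a ∷ ts) (a ↑ʳ y) FinP.≟ Fin.zero))
      ≡⟨ cong₂ _+_ (∑-cong (allFin a) (λ x → cong (λ c → χ (does (c FinP.≟ Fin.zero))) (cls-↑ˡ a ts x)))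
                   (∑-cong (allFin (sumV ts)) (λ y → cong (λ c → χ (does (c FinP.≟ Fin.zero))) (cls-↑ʳ a ts y))) ⟩
    ∑[ _ ∈ allFin a ] 1 + ∑[ _ ∈ allFin (sumV ts) ] 0
      ≡⟨ cong₂ _+_ (trans (∑-allFin-const a 1) (*-identityʳ a)) (∑-zero (allFin (sumV ts))) ⟩
    a + 0
      ≡⟨ +-identityʳ a ⟩
    a ∎
    where open ≡-Reasoning
  split (Fin.suc i) = begin
    ∑[ x ∈ allFin a ] χ (does (cls (a ∷ ts) (x ↑ˡ sumV ts) FinP.≟ Fin.suc i))
      + ∑[ y ∈ allFin (sumV ts) ] χ (does (cls (a ∷ ts) (a ↑ʳ y) FinP.≟ Fin.suc i))
      ≡⟨ cong₂ _+_ (∑-cong (allFin a) (λ x → cong (λ c → χ (does (c FinP.≟ Fin.suc i))) (cls-↑ˡ a ts x)))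
                   (∑-cong (allFin (sumV ts)) (λ y → cong (λ c → χ (does (c FinP.≟ Fin.suc i))) (cls-↑ʳ a ts y))) ⟩
    ∑[ _ ∈ allFin a ] 0 + ∑[ y ∈ allFin (sumV ts) ] χ (does (cls ts y FinP.≟ i))
      ≡⟨ cong₂ _+_ (∑-zero (allFin a)) (class-size ts i) ⟩
    lookup ts i ∎
    where open ≡-Reasoning

cls-mono : ∀ {k} (t : Vec ℕ k) {u v : Fin (sumV t)} → toℕ u ≤ toℕ v → toℕ (cls t u) ≤ toℕ (cls t v)
cls-mono (a ∷ ts) {u} {v} u≤v with splitAt a u in split-u | splitAt a v in split-v
... | inj₁ _ | _       = z≤n
... | inj₂ y | inj₁ x  = ⊥-elim (<⇒≱ v<a (≤-trans a≤u u≤v))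
  where
  v<a : toℕ v < a
  v<a = subst (_< a) (trans (sym (FinP.toℕ-↑ˡ x (sumV ts))) (cong toℕ (FinP.splitAt⁻¹-↑ˡ split-v))) (FinP.toℕ<n x)
  a≤u : a ≤ toℕ u
  a≤u = subst (a ≤_) (trans (sym (FinP.toℕ-↑ʳ a y)) (cong toℕ (FinP.splitAt⁻¹-↑ʳ split-u))) (m≤m+n a (toℕ y))
... | inj₂ y | inj₂ y′ = s≤s (cls-mono ts (+-cancelˡ-≤ a _ _ (subst₂ _≤_ (toℕ-u y split-u) (toℕ-u y′ split-v) u≤v)))
  where
  toℕ-u : ∀ {w} z → splitAt a w ≡ inj₂ z → toℕ w ≡ a + toℕ z
  toℕ-u z split = trans (cong toℕ (sym (FinP.splitAt⁻¹-↑ʳ split))) (FinP.toℕ-↑ʳ a z)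

map-act : ∀ {r n m} (f : Fin n → Fin m) (σ : Vec (Fin r) r) (x : Vec (Fin n) r) →
  map f (act σ x) ≡ act σ (map f x)
map-act f σ x = Pointwise-≡⇒≡ (ext λ i → begin
  lookup (map f (act σ x)) i   ≡⟨ VecP.lookup-map i f (act σ x) ⟩
  f (lookup (act σ x) i)       ≡⟨ cong f (lookup-act σ x i) ⟩
  f (lookup x (lookup σ i))    ≡⟨ sym (VecP.lookup-map (lookup σ i) f x) ⟩
  lookup (map f x) (lookup σ i) ≡⟨ sym (lookup-act σ (map f x) i) ⟩
  lookup (act σ (map f x)) i   ∎)
  where open ≡-Reasoning

-- S(t) with its vertices numbered in reverse, so that the minimal-code representative of
-- an edge lists its vertices in the order of their classes
module Blowup (Th : GDH) (t : Vec ℕ (r Th)) where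

  class : Fin (sumV t) → Fin (r Th)
  class v = cls t (opposite v)

  edge? : Vec (Fin (sumV t)) (r Th) → Bool
  edge? y = singleEdgeE Th (map class y)

  edge?-distinct : ∀ y → T (edge? y) → Distinct y
  edge?-distinct y y∈E i j yᵢ≡yⱼ =
    J-perm Th (singleEdge⇒∈J Th (map class y) y∈E) i j (begin
      lookup (map class y) i ≡⟨ VecP.lookup-map i class y ⟩
      class (lookup y i)     ≡⟨ cong class yᵢ≡yⱼ ⟩
      class (lookup y j)     ≡⟨ sym (VecP.lookup-map j class y) ⟩
      lookup (map class y) j ∎)
    where open ≡-Reasoning

  -- act τ (map class y) is map class y ⊙ τ by definition of act and _⊙_
  edge?-closed : ∀ {τ} → τ ∈ J Th → ∀ y → T (edge? y) → T (edge? (act τ y))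
  edge?-closed {τ} τ∈J y y∈E = ∈J⇒singleEdge Th _
    (subst (_∈ J Th) (sym (map-act class τ y)) (J-comp Th (singleEdge⇒∈J Th (map class y) y∈E) τ∈J))

  graph : TGraph Th
  graph = record { n = sumV t ; E = edge? ; E-dist = edge?-distinct ; E-closed = edge?-closed }

  copy-in-blowup : (F : TGraph Th) → Copy F (sumV t) edge? → Copy F (sumV t) (blowupE (singleEdgeE Th) t)
  copy-in-blowup F (φ , φ-injective , φ-edges) =
    (λ v → opposite (φ v)) ,
    (λ i j e → φ-injective i j (begin
      φ i                     ≡⟨ sym (FinP.opposite-involutive (φ i)) ⟩
      opposite (opposite (φ i)) ≡⟨ cong opposite e ⟩
      opposite (opposite (φ j)) ≡⟨ FinP.opposite-involutive (φ j) ⟩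
      φ j                     ∎)) ,
    (λ x x∈F → subst (λ z → T (singleEdgeE Th (map (cls t) z))) (sym (VecP.map-∘ opposite φ x))
                     (subst (λ z → T (singleEdgeE Th z)) (VecP.map-∘ (cls t) opposite (map φ x)) (φ-edges x x∈F)))
    where open ≡-Reasoning

  Transversal : Vec (Fin (sumV t)) (r Th) → Set
  Transversal y = ∀ i → class (lookup y i) ≡ i

  transversal-decreasing : ∀ y → Transversal y → ∀ {i j} → i Fin.< j → toℕ (lookup y j) < toℕ (lookup y i)
  transversal-decreasing y y-transversal {i} {j} i<j with toℕ (lookup y j) <? toℕ (lookup y i)
  ... | yes yⱼ<yᵢ = yⱼ<yᵢ
  ... | no  yⱼ≮yᵢ = ⊥-elim (<⇒≱ i<j (subst₂ _≤_ (cong toℕ (y-transversal j)) (cong toℕ (y-transversal i))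
                                       (cls-mono t opposite-yⱼ≤opposite-yᵢ)))
    where
    opposite-yⱼ≤opposite-yᵢ : toℕ (opposite (lookup y j)) ≤ toℕ (opposite (lookup y i))
    opposite-yⱼ≤opposite-yᵢ = subst₂ _≤_ (sym (FinP.opposite-prop (lookup y j))) (sym (FinP.opposite-prop (lookup y i)))
                                      (∸-monoʳ-≤ (sumV t) (s≤s (≮⇒≥ yⱼ≮yᵢ)))

  transversal-least : ∀ y → Transversal y → ∀ {σ} → σ ∈ J Th → code y ≤ code (act σ y)
  transversal-least y y-transversal {σ} σ∈J = begin
    code y                                              ≡⟨ code≡codeF y ⟩
    codeF (sumV t) (r Th) w                             ≤⟨ codeF-decreasing-least (sumV t) (r Th) w (lookup σ)
                                                             (J-perm Th σ∈J _ _) (transversal-decreasing y y-transversal)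
                                                             (λ i → FinP.toℕ<n (lookup y i)) ⟩
    codeF (sumV t) (r Th) (λ i → w (lookup σ i))        ≡⟨ codeF-cong (sumV t) (r Th) (λ i → cong toℕ (sym (lookup-act σ y i))) ⟩
    codeF (sumV t) (r Th) (λ i → toℕ (lookup (act σ y) i)) ≡⟨ sym (code≡codeF (act σ y)) ⟩
    code (act σ y)                                      ∎
    where
    open ≤-Reasoning
    w : Fin (r Th) → ℕ
    w i = toℕ (lookup y i)

  transversal-representative : ∀ y → Transversal y →
    T (edge? y ∧ allB (λ σ → code y ≤ᵇ code (act σ y)) (J Th))
  transversal-representative y y-transversal = Equivalence.from T-∧
    (∈J⇒singleEdge Th (map class y) (subst (_∈ J Th) (sym classes≡idPerm) (J-id Th)) ,
     allB-intro _ (J Th) (λ σ∈J → ≤⇒≤ᵇ (transversal-least y y-transversal σ∈J)))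
    where
    classes≡idPerm : map class y ≡ idPerm (r Th)
    classes≡idPerm = Pointwise-≡⇒≡ (ext λ i →
      trans (VecP.lookup-map i class y) (trans (y-transversal i) (sym (VecP.lookup∘tabulate (λ j → j) i))))

  ∏≤eT : ∏ (r Th) (lookup t) ≤ eT graph
  ∏≤eT = begin
    ∏ (r Th) (lookup t)
      ≡⟨ ∏-cong (r Th) (λ i → sym (trans (∑-allFin-opposite (sumV t) (λ v → χ (does (cls t v FinP.≟ i)))) (class-size t i))) ⟩
    ∏ (r Th) (λ i → ∑[ v ∈ allFin (sumV t) ] χ (does (class v FinP.≟ i)))
      ≡⟨ sym (∑-allVecs-∏ (sumV t) (r Th) (λ i v → χ (does (class v FinP.≟ i)))) ⟩
    ∑[ y ∈ allVecs (sumV t) (r Th) ] ∏ (r Th) (λ i → χ (does (class (lookup y i) FinP.≟ i)))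
      ≤⟨ ∑-mono-≤ (allVecs (sumV t) (r Th)) (λ y → ∏-χ≤χ (r Th) _ _ (λ all-in-class →
           transversal-representative y (λ i → does-true (class (lookup y i) FinP.≟ i) (all-in-class i)))) ⟩
    ∑[ y ∈ allVecs (sumV t) (r Th) ] χ (edge? y ∧ allB (λ σ → code y ≤ᵇ code (act σ y)) (J Th))
      ≡⟨ sym (countB≡∑χ _ (allVecs (sumV t) (r Th))) ⟩
    eT graph ∎
    where open ≤-Reasoning

-- Necessity and the lower bound

a*[1+a]^k≤ : ∀ a k → 1 ≤ a → a * suc a ^ k ≤ a ^ suc k + k * 2 ^ k * a ^ k
a*[1+a]^k≤ a zero    _   = ≤-reflexive (sym (+-identityʳ (a * 1)))
a*[1+a]^k≤ a (suc k) 1≤a = begin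
  a * (suc a * suc a ^ k)
    ≡⟨ reassoc a (suc a ^ k) ⟩
  (a * suc a ^ k) * suc a
    ≤⟨ *-monoˡ-≤ (suc a) (a*[1+a]^k≤ a k 1≤a) ⟩
  (a * aᵏ + D * aᵏ) * suc a
    ≡⟨ expand aᵏ D a ⟩
  a * (a * aᵏ) + (a * aᵏ + D * (a * aᵏ) + D * aᵏ)
    ≤⟨ +-monoʳ-≤ (a * (a * aᵏ)) (+-monoʳ-≤ (a * aᵏ + D * (a * aᵏ)) (*-monoʳ-≤ D (m≤n*m aᵏ a {{>-nonZero 1≤a}}))) ⟩
  a * (a * aᵏ) + (a * aᵏ + D * (a * aᵏ) + D * (a * aᵏ))
    ≡⟨ collect a aᵏ D ⟩
  a * (a * aᵏ) + (1 + 2 * D) * (a * aᵏ)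
    ≤⟨ +-monoʳ-≤ (a * (a * aᵏ)) (*-monoˡ-≤ (a * aᵏ) 1+2D≤) ⟩
  a * (a * aᵏ) + suc k * 2 ^ suc k * (a * aᵏ) ∎
  where
  open ≤-Reasoning
  aᵏ = a ^ k
  D = k * 2 ^ k
  1+2D≤ : 1 + 2 * D ≤ suc k * 2 ^ suc k
  1+2D≤ = begin
    1 + 2 * (k * 2 ^ k)           ≤⟨ +-monoˡ-≤ _ (≤-trans (m^n>0 2 k) (m≤m+n (2 ^ k) (2 ^ k + 0))) ⟩
    2 * 2 ^ k + 2 * (k * 2 ^ k)   ≡⟨ factor k (2 ^ k) ⟩
    suc k * (2 * 2 ^ k)           ∎
    where
    factor : ∀ k p → 2 * p + 2 * (k * p) ≡ suc k * (2 * p)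
    factor = solve-∀
  reassoc : ∀ a b → a * (suc a * b) ≡ (a * b) * suc a
  reassoc = solve-∀
  expand : ∀ aᵏ D a → (a * aᵏ + D * aᵏ) * suc a ≡ a * (a * aᵏ) + (a * aᵏ + D * (a * aᵏ) + D * aᵏ)
  expand = solve-∀
  collect : ∀ a aᵏ D → a * (a * aᵏ) + (a * aᵏ + D * (a * aᵏ) + D * (a * aᵏ)) ≡ a * (a * aᵏ) + (1 + 2 * D) * (a * aᵏ)
  collect = solve-∀

-- With X = r! C(n,r), A = a^r, B = (a+1)^r and R = r^r, the balanced blowup has density at least
-- m A / X ≥ m A / (R B), and A / B ≥ a / (a + D) ≥ 1 - 1/c.
density-margin : ∀ {c X R A B a D} → 1 ≤ a → X ≤ R * B → a * B ≤ a * A + D * A → A ≤ X → c * D ≤ a →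
  c * X ≤ c * R * A + R * X
density-margin {c} {X} {R} {A} {B} {a} {D} 1≤a X≤RB aB≤ A≤X cD≤a = *-cancelˡ-≤ a {{>-nonZero 1≤a}} (begin
  a * (c * X)                       ≤⟨ *-monoʳ-≤ a (*-monoʳ-≤ c X≤RB) ⟩
  a * (c * (R * B))                 ≡⟨ reorder a c R B ⟩
  c * R * (a * B)                   ≤⟨ *-monoʳ-≤ (c * R) aB≤ ⟩
  c * R * (a * A + D * A)           ≡⟨ expand c R a A D ⟩
  a * (c * R * A) + c * D * (R * A) ≤⟨ +-monoʳ-≤ (a * (c * R * A)) (*-monoˡ-≤ (R * A) cD≤a) ⟩
  a * (c * R * A) + a * (R * A)     ≤⟨ +-monoʳ-≤ (a * (c * R * A)) (*-monoʳ-≤ a (*-monoʳ-≤ R A≤X)) ⟩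
  a * (c * R * A) + a * (R * X)     ≡⟨ sym (*-distribˡ-+ a _ _) ⟩
  a * (c * R * A + R * X)           ∎)
  where
  open ≤-Reasoning
  reorder : ∀ a c R B → a * (c * (R * B)) ≡ c * R * (a * B)
  reorder = solve-∀
  expand : ∀ c R a A D → c * R * (a * A + D * A) ≡ a * (c * R * A) + c * D * (R * A)
  expand = solve-∀

balanced : (m n a : ℕ) → Vec ℕ m
balanced zero    n a = []
balanced (suc k) n a = (n ∸ k * a) ∷ replicate k a

sumV-replicate : ∀ k a → sumV (replicate k a) ≡ k * a
sumV-replicate zero    a = refl
sumV-replicate (suc k) a = cong (a +_) (sumV-replicate k a)

sumV-balanced : ∀ m n a → 1 ≤ m → m * a ≤ n → sumV (balanced m n a) ≡ n
sumV-balanced (suc k) n a _ ma≤n =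
  trans (cong (n ∸ k * a +_) (sumV-replicate k a)) (m∸n+n≡m (≤-trans (m≤n+m (k * a) a) ma≤n))

balanced-≥ : ∀ m n a → m * a ≤ n → ∀ i → a ≤ lookup (balanced m n a) i
balanced-≥ (suc k) n a ma≤n Fin.zero    = subst (_≤ n ∸ k * a) (m+n∸n≡m a (k * a)) (∸-monoˡ-≤ (k * a) ma≤n)
balanced-≥ (suc k) n a ma≤n (Fin.suc i) = ≤-reflexive (sym (VecP.lookup-replicate i a))

n+m≤m*n : ∀ m n → 2 ≤ m → 2 ≤ n → n + m ≤ m * n
n+m≤m*n (suc (suc m)) (suc (suc n)) (s≤s (s≤s z≤n)) (s≤s (s≤s z≤n)) =
  subst (suc (suc n) + suc (suc m) ≤_) (sym (expand m n)) (m≤m+n (suc (suc n) + suc (suc m)) (m * n + m + n))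
  where
  expand : ∀ m n → suc (suc m) * suc (suc n) ≡ (suc (suc n) + suc (suc m)) + (m * n + m + n)
  expand = solve-∀

module BalancedBlowup (Th : GDH) (n₀ K : ℕ) (2≤K : 2 ≤ K) (rK≤n₀ : r Th * K ≤ n₀) where

  1≤r : 1 ≤ r Th
  1≤r = ≤-trans (s≤s z≤n) (2≤r Th)

  instance
    r≢0 : NonZero (r Th)
    r≢0 = >-nonZero 1≤r

  a : ℕ
  a = n₀ / r Th

  K≤a : K ≤ a
  K≤a = subst (_≤ a) (trans (cong (_/ r Th) (*-comm (r Th) K)) (m*n/n≡m K (r Th))) (/-monoˡ-≤ (r Th) rK≤n₀)

  2≤a : 2 ≤ a
  2≤a = ≤-trans 2≤K K≤a

  1≤a : 1 ≤ a
  1≤a = ≤-trans (s≤s z≤n) 2≤a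

  ra≤n₀ : r Th * a ≤ n₀
  ra≤n₀ = subst (_≤ n₀) (*-comm a (r Th)) (m/n*n≤m n₀ (r Th))

  n₀≤r[1+a] : n₀ ≤ r Th * suc a
  n₀≤r[1+a] = begin
    n₀                    ≡⟨ m≡m%n+[m/n]*n n₀ (r Th) ⟩
    n₀ % r Th + a * r Th  ≤⟨ +-monoˡ-≤ (a * r Th) (<⇒≤ (m%n<n n₀ (r Th))) ⟩
    r Th + a * r Th       ≡⟨ cong (r Th +_) (*-comm a (r Th)) ⟩
    r Th + r Th * a       ≡⟨ sym (*-suc (r Th) a) ⟩
    r Th * suc a          ∎
    where open ≤-Reasoning

  r≤n₀ : r Th ≤ n₀
  r≤n₀ = ≤-trans (m≤m*n (r Th) a {{>-nonZero 1≤a}}) ra≤n₀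

  open Blowup Th (balanced (r Th) n₀ a) public using (graph; copy-in-blowup; ∏≤eT)

  n-graph : n graph ≡ n₀
  n-graph = sumV-balanced (r Th) n₀ a 1≤r ra≤n₀

  a^r≤eT : a ^ r Th ≤ eT graph
  a^r≤eT = begin
    a ^ r Th                                ≡⟨ sym (∏-const (r Th) a) ⟩
    ∏ (r Th) (λ _ → a)                      ≤⟨ ∏-mono-≤ (r Th) (balanced-≥ (r Th) n₀ a ra≤n₀) ⟩
    ∏ (r Th) (lookup (balanced (r Th) n₀ a)) ≤⟨ ∏≤eT ⟩
    eT graph                                ∎
    where open ≤-Reasoning

  r!*C≤r^r*[1+a]^r : r Th ! * (n₀ C r Th) ≤ r Th ^ r Th * suc a ^ r Th
  r!*C≤r^r*[1+a]^r = begin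
    r Th ! * (n₀ C r Th)      ≤⟨ k!*nCk≤n^k r≤n₀ ⟩
    n₀ ^ r Th                 ≤⟨ ^-monoˡ-≤ (r Th) n₀≤r[1+a] ⟩
    (r Th * suc a) ^ r Th     ≡⟨ ^-distribʳ-* (r Th) (suc a) (r Th) ⟩
    r Th ^ r Th * suc a ^ r Th ∎
    where open ≤-Reasoning

  a^r≤r!*C : a ^ r Th ≤ r Th ! * (n₀ C r Th)
  a^r≤r!*C = ≤-trans (^-monoˡ-≤ (r Th) a≤n₀∸r) ([n∸k]^k≤k!*nCk r≤n₀)
    where
    a≤n₀∸r : a ≤ n₀ ∸ r Th
    a≤n₀∸r = subst (_≤ n₀ ∸ r Th) (m+n∸n≡m a (r Th))
               (∸-monoˡ-≤ (r Th) (≤-trans (n+m≤m*n (r Th) a (2≤r Th) 2≤a) ra≤n₀))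

  contains⇒inBlowup : (𝓕 : TGraph Th → Set) → Contains 𝓕 graph → ∃ λ F → 𝓕 F × InBlowupOfEdge Th F
  contains⇒inBlowup 𝓕 (F , F∈𝓕 , F⊆graph) =
    F , F∈𝓕 , balanced (r Th) n₀ a , (λ i → ≤-trans 1≤a (balanced-≥ (r Th) n₀ a ra≤n₀ i)) , copy-in-blowup F F⊆graph

PiZero⇒blowup : (Th : GDH) (𝓕 : TGraph Th → Set) → PiZero Th 𝓕 → ∃ λ F → 𝓕 F × InBlowupOfEdge Th F
PiZero⇒blowup Th 𝓕 piZero = contains⇒inBlowup 𝓕 (proj₂ zero-density graph N≤n (subst many-edges (sym n-graph) dense))
  where
  q = 2 ^ r Th * r Th ^ r Th
  1≤q : 1 ≤ q
  1≤q = *-mono-≤ (m^n>0 2 (r Th)) (m^n>0 (r Th) {{>-nonZero (≤-trans (s≤s z≤n) (2≤r Th))}} (r Th))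
  zero-density = piZero 1 q ≤-refl 1≤q
  N = proj₁ zero-density
  open BalancedBlowup Th (N + r Th * 2) 2 ≤-refl (m≤n+m (r Th * 2) N)
  N≤n : N ≤ n graph
  N≤n = subst (N ≤_) (sym n-graph) (m≤m+n N (r Th * 2))
  many-edges : ℕ → Set
  many-edges n = 1 * r Th ! * (n C r Th) ≤ q * m Th * eT graph
  dense : many-edges (N + r Th * 2)
  dense = begin
    1 * r Th ! * ((N + r Th * 2) C r Th)  ≡⟨ cong (_* ((N + r Th * 2) C r Th)) (*-identityˡ (r Th !)) ⟩
    r Th ! * ((N + r Th * 2) C r Th)      ≤⟨ r!*C≤r^r*[1+a]^r ⟩
    r Th ^ r Th * suc a ^ r Th            ≤⟨ *-monoʳ-≤ (r Th ^ r Th) (^-monoˡ-≤ (r Th) 1+a≤2a) ⟩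
    r Th ^ r Th * (2 * a) ^ r Th          ≡⟨ cong (r Th ^ r Th *_) (^-distribʳ-* 2 a (r Th)) ⟩
    r Th ^ r Th * (2 ^ r Th * a ^ r Th)   ≡⟨ x∙yz≈y∙xz (r Th ^ r Th) (2 ^ r Th) _ ⟩
    2 ^ r Th * (r Th ^ r Th * a ^ r Th)   ≡⟨ sym (*-assoc (2 ^ r Th) _ _) ⟩
    q * a ^ r Th                          ≤⟨ *-monoʳ-≤ q a^r≤eT ⟩
    q * eT graph                          ≤⟨ *-monoˡ-≤ (eT graph) (m≤m*n q (m Th) {{>-nonZero (1≤m Th)}}) ⟩
    q * m Th * eT graph                   ∎
    where
    open ≤-Reasoning
    open import Algebra.Properties.CommutativeSemigroup *-commutativeSemigroup using (x∙yz≈y∙xz)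
    1+a≤2a : suc a ≤ 2 * a
    1+a≤2a = subst (suc a ≤_) (cong (a +_) (sym (+-identityʳ a))) (subst (_≤ a + a) (+-comm a 1) (+-monoʳ-≤ a 1≤a))

¬blowup⇒PiAtLeast : (Th : GDH) (𝓕 : TGraph Th → Set) →
  ¬ (∃ λ F → 𝓕 F × InBlowupOfEdge Th F) → PiAtLeast Th 𝓕 (m Th) (r Th ^ r Th)
¬blowup⇒PiAtLeast Th 𝓕 ¬blowup p q 1≤p 1≤q = r Th * K , extremal
  where
  D = r Th * 2 ^ r Th
  K = m Th * q * D + 2
  extremal : ∀ n₀ → r Th * K ≤ n₀ → Σ (TGraph Th) λ G → n G ≡ n₀ × Free 𝓕 G ×
    m Th * q * r Th ! * (n₀ C r Th) ≤ eT G * m Th * (r Th ^ r Th) * q + p * (r Th ^ r Th) * r Th ! * (n₀ C r Th)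
  extremal n₀ rK≤n₀ = graph , n-graph , (λ contains → ¬blowup (contains⇒inBlowup 𝓕 contains)) , (begin
    m Th * q * r Th ! * (n₀ C r Th)
      ≡⟨ *-assoc (m Th * q) _ _ ⟩
    m Th * q * X
      ≤⟨ density-margin {c = m Th * q} {R = R} {D = D} 1≤a r!*C≤r^r*[1+a]^r (a*[1+a]^k≤ a (r Th) 1≤a) a^r≤r!*C mqD≤a ⟩
    m Th * q * R * a ^ r Th + R * X
      ≤⟨ +-mono-≤ (*-monoʳ-≤ (m Th * q * R) a^r≤eT) (m≤n*m (R * X) p {{>-nonZero 1≤p}}) ⟩
    m Th * q * R * eT graph + p * (R * X)
      ≡⟨ reorder (m Th) q R (eT graph) p (r Th !) (n₀ C r Th) ⟩
    eT graph * m Th * R * q + p * R * r Th ! * (n₀ C r Th) ∎)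
    where
    open ≤-Reasoning
    open BalancedBlowup Th n₀ K (m≤n+m 2 _) rK≤n₀
    R = r Th ^ r Th
    X = r Th ! * (n₀ C r Th)
    mqD≤a : m Th * q * D ≤ a
    mqD≤a = ≤-trans (m≤m+n (m Th * q * D) 2) K≤a
    reorder : ∀ m q R e p f c → m * q * R * e + p * (R * (f * c)) ≡ e * m * R * q + p * R * f * c
    reorder = solve-∀

mainTheorem6 : (Th : GDH) (𝓕 : TGraph Th → Set) →
    (PiZero Th 𝓕 ⇔ (∃ λ F → 𝓕 F × InBlowupOfEdge Th F)) ×
    (¬ (∃ λ F → 𝓕 F × InBlowupOfEdge Th F) → PiAtLeast Th 𝓕 (m Th) (r Th ^ r Th))
mainTheorem6 Th 𝓕 = mk⇔ (PiZero⇒blowup Th 𝓕) (blowup⇒PiZero Th 𝓕) , ¬blowup⇒PiAtLeast Th 𝓕
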